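{- Let $n$ be a positive integer and $t,e$ non-negative integers. The number of set-valued standard tableaux of shape $(e+t,e)$ with $n$ entries is $$\chi(e=0)\binom {n-1}{t-1}+\sum_{d=0}^{n-2e-t}\frac {(n-1)!}{(n-d-2e-t)!\,d!\,(e-1)!\,(e+t-1)!}\cdot\left(\frac {1} {d+e}-\frac {n-d-e-t-1} {(d+e+t+1)(d+e+t)}\right).$$
   Context: Shapes: for integers $\lambda_1\ge\lambda_2\ge0$, the (straight) two-rowed shape $(\lambda_1,\lambda_2)$ consists of cells $(1,j)$, $1\le j\le\lambda_1$ (first row, on top) and $(2,j)$, $1\le j\le \lambda_2$ (second row), left-justified. A set-valued standard tableau of this shape with $n$ entries is a filling of the cells with the numbers $1,2,\dots,n$, each used exactly once, each cell receiving a nonempty set of numbers, such that every number in a cell $(i,j)$ is smaller than every number in every other cell $(i',j')$ of the shape with $i'\ge i$ and $j'\ge j$. $\chi(\mathcal S)=1$ if $\mathcal S$ is true and $0$ otherwise. Convention: any term containing $m!$ with $m<0$ in its denominator is interpreted as $0$; $\binom{a}{k}=a(a-1)\cdots(a-k+1)/k!$ for integers $k\ge0$ and $\binom ak=0$ for $k<0$. -}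

module Defs where

open import Data.Bool using (Bool; true; false; if_then_else_; _∧_)
open import Data.Nat as ℕ using (ℕ; zero; suc; _+_; _*_; _∸_; _≤_; _<_; _≤ᵇ_; _≟_; _≤?_)
open import Data.Nat.Combinatorics using (_C_)
open import Data.Nat using (_!)
open import Data.Fin using (Fin; toℕ) renaming (_<_ to _<ᶠ_; _<?_ to _<ᶠ?_)
open import Data.Fin.Properties using (all?; any?)
open import Data.Vec using (Vec; lookup)
open import Data.List using (List; []; _∷_; map; upTo; _++_; length; filter; concatMap; foldr)
open import Data.List.Membership.Propositional using (_∈_)
open import Data.List.Membership.DecPropositional using () renaming (_∈?_ to ∈?-gen)
open import Data.List.Relation.Unary.All as All using (All)
open import Data.Product using (_×_; _,_; proj₁; proj₂; ∃)
open import Data.Product.Properties using (≡-dec)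
open import Relation.Binary.PropositionalEquality using (_≡_; _≢_)
open import Relation.Nullary using (Dec; ¬_)
open import Relation.Nullary.Decidable using (_×-dec_; _→-dec_; ¬?)
open import Data.Integer as ℤ using (ℤ; +_)
open import Data.Rational as ℚ using (ℚ; 0ℚ)

-- A cell (i , j): row i, column j (1-indexed).
Cell : Set
Cell = ℕ × ℕ

_≟ᶜ_ : (c d : Cell) → Dec (c ≡ d)
_≟ᶜ_ = ≡-dec _≟_ _≟_

shapeCells : ℕ → ℕ → List Cell
shapeCells λ₁ λ₂ = map (λ j → (1 , suc j)) (upTo λ₁) ++ map (λ j → (2 , suc j)) (upTo λ₂)

_≼_ : Cell → Cell → Set
(i , j) ≼ (i' , j') = (i ≤ i') × (j ≤ j')

-- A filling of the shape with the numbers 1,…,n is given by the vector v,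
-- where the number (toℕ a + 1) is placed in cell  lookup v a
-- (so every number is used exactly once).
IsSVT : (λ₁ λ₂ n : ℕ) → Vec Cell n → Set
IsSVT λ₁ λ₂ n v =
    (∀ a → lookup v a ∈ shapeCells λ₁ λ₂)
  × All (λ c → ∃ λ a → lookup v a ≡ c) (shapeCells λ₁ λ₂)
  × (∀ a b → lookup v a ≢ lookup v b → lookup v a ≼ lookup v b → a <ᶠ b)

isSVT? : (λ₁ λ₂ n : ℕ) → (v : Vec Cell n) → Dec (IsSVT λ₁ λ₂ n v)
isSVT? λ₁ λ₂ n v =
  all? (λ a → ∈?-gen _≟ᶜ_ (lookup v a) (shapeCells λ₁ λ₂))
  ×-dec All.all? (λ c → any? (λ a → lookup v a ≟ᶜ c)) (shapeCells λ₁ λ₂)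
  ×-dec all? (λ a → all? (λ b →
          ¬? (lookup v a ≟ᶜ lookup v b) →-dec
          ((proj₁ (lookup v a) ≤? proj₁ (lookup v b) ×-dec proj₂ (lookup v a) ≤? proj₂ (lookup v b))
            →-dec (a <ᶠ? b))))

allVecs : {A : Set} → (n : ℕ) → List A → List (Vec A n)
allVecs zero    xs = Data.Vec.[] ∷ []
allVecs (suc n) xs = concatMap (λ x → map (x Data.Vec.∷_) (allVecs n xs)) xs

-- Number of set-valued standard tableaux of shape (λ₁ , λ₂) with n entries.
-- (Any filling of the shape maps each number to a cell of the shape, so it suffices
--  to enumerate the vectors over the cells of the shape.)
numSVT : (λ₁ λ₂ n : ℕ) → ℕ
numSVT λ₁ λ₂ n = length (filter (isSVT? λ₁ λ₂ n) (allVecs n (shapeCells λ₁ λ₂)))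

-- a / m as a rational; the value for m = 0 is never used below (all uses are
-- guarded so that the denominator is positive).
frac : ℤ → ℕ → ℚ
frac a zero    = 0ℚ
frac a (suc m) = a ℚ./ suc m

sumℚ : List ℚ → ℚ
sumℚ = foldr ℚ._+_ 0ℚ

-- χ(e = 0) · binom(n-1, t-1), with binom(a,k) = 0 for k < 0.
chiTerm : (n t e : ℕ) → ℚ
chiTerm n t zero    with t
... | zero  = 0ℚ
... | suc s = frac (+ ((n ∸ 1) C s)) 1
chiTerm n t (suc _) = 0ℚ

-- The d-th summand.  By the stated convention it is 0 when a factorial of a
-- negative number appears in a denominator, i.e. unless
-- n-d-2e-t ≥ 0, e-1 ≥ 0 and e+t-1 ≥ 0.
summand : (n t e d : ℕ) → ℚ
summand n t e d =
  if (d + 2 * e + t ≤ᵇ n) ∧ (1 ≤ᵇ e) ∧ (1 ≤ᵇ e + t)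
  then frac (+ ((n ∸ 1) !)) (((n ∸ (d + 2 * e + t)) !) * (d !) * ((e ∸ 1) !) * ((e + t ∸ 1) !))
       ℚ.* (frac (+ 1) (d + e)
            ℚ.- frac ((+ n) ℤ.- (+ (d + e + t + 1))) ((d + e + t + 1) * (d + e + t)))
  else 0ℚ

-- χ(e=0) binom(n-1,t-1) + Σ_{d=0}^{n-2e-t} (summand).  Summing d over 0..n and
-- letting the guard in 'summand' cut off at n-2e-t gives the same sum (empty if n-2e-t < 0).
formula : (n t e : ℕ) → ℚ
formula n t e = chiTerm n t e ℚ.+ sumℚ (map (summand n t e) (upTo (suc n)))

{-# OPTIONS --safe #-}
-- The largest entry n + 1 of a set-valued tableau of shape λ sits in a corner c of λ, either alone
-- (removing it leaves a tableau of λ ∖ c) or not (a tableau of λ), so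
-- N(λ, n + 1) = Σ_c (N(λ, n) + N(λ ∖ c, n)).  For λ = (e + t, e) the corners are (1, e + t) if t > 0
-- and (2, e) if e > 0.  The formula F(n, t, e) satisfies the same recurrence for n ≥ 1 and agrees with
-- N at n = 1.  For e = 0 it is a binomial coefficient and the recurrence is Pascal's rule.  For t, e > 0
-- the summands satisfy, for each d, the Pascal-type rule
--   s(n + 1, t, e, d) = s(n, t, e, d) + s(n, t − 1, e, d) + s(n, t + 1, e − 1, d) + s(n, t, e, d − 1),
-- where at d = 0 the last term is the boundary term χ(e = 1) binom(n − 1, t); summing over d gives
-- the recurrence.  For t = 0 the summands telescope against an explicit certificate instead.  In the
-- coordinates m = n − d − 2e − t, d, e − 1, t all terms of such an identity are one multinomial
-- coefficient times rational functions, and the identity becomes a ring identity once the reciprocals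
-- of d + e, d + e + t, ... are treated as variables subject to x · (1/x) = 1.
module Submission where

open import Level using (0ℓ)
open import Data.Bool using (T; true; false; if_then_else_)
open import Data.Empty using (⊥-elim)
open import Data.Unit using (tt)
open import Data.Maybe using (Maybe; just; nothing)
import Data.Nat as ℕ
open ℕ using (ℕ; zero; suc; _!)
import Data.Nat.Properties as ℕP
import Data.Nat.Tactic.RingSolver as ℕ-Solver
open import Data.Nat.Combinatorics
  using (_C_; nCk≡n!/k![n-k]!; k![n∸k]!∣n!; k>n⇒nCk≡0; nCk+nC[k+1]≡[n+1]C[k+1])
open import Data.Nat.DivMod using (m/n*n≡m)
import Data.Integer as ℤ
import Data.Integer.Properties as ℤP
import Data.Integer.Tactic.RingSolver as ℤ-Solver
open import Data.Rational as ℚ using (ℚ; 0ℚ; 1ℚ)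
import Data.Rational.Properties as ℚP
import Data.Rational.Unnormalised as ℚᵘ
import Data.Rational.Unnormalised.Properties as ℚᵘP
open import Data.Fin as Fin using (Fin; fromℕ; inject₁) renaming (_<_ to _<ᶠ_; _<?_ to _<ᶠ?_)
open import Data.Fin.Properties using (all?; any?; toℕ-inject₁; toℕ-fromℕ; toℕ<n)
open import Data.Fin.Relation.Unary.Top using (view; ‵fromℕ; ‵inject₁)
open import Data.Vec as Vec using (Vec; lookup; _∷ʳ_)
open import Data.List using (List; []; _∷_; _++_; [_]; map; upTo; applyUpTo; filter; concatMap; length)
import Data.List.Properties as ListP
open import Data.List.Membership.Propositional using (_∈_)
open import Data.List.Membership.Propositional.Properties
  using (∈-filter⁺; ∈-filter⁻; ∈-++⁻; ∈-++⁺ˡ; ∈-++⁺ʳ; ∈-map⁺; ∈-map⁻; ∈-upTo⁺; ∈-upTo⁻)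
open import Data.List.Membership.DecPropositional using () renaming (_∈?_ to ∈?-gen)
open import Data.List.Relation.Unary.All as All using (All)
open import Data.List.Relation.Unary.Any using (here; there)
open import Data.Product using (_×_; _,_; proj₁; proj₂; ∃; ∃-syntax)
open import Data.Sum using (_⊎_; inj₁; inj₂; [_,_]′)
open import Function using (_∘_)
open import Relation.Nullary using (Dec; yes; no; ¬_)
open import Relation.Nullary.Decidable using (_×-dec_; _→-dec_; ¬?)
open import Relation.Unary using (Decidable)
open import Relation.Binary.PropositionalEquality hiding ([_])
import Relation.Binary.Reasoning.Setoid as SetoidReasoning
open import Tactic.RingSolver using (solve-∀)
open import Tactic.RingSolver.Core.AlmostCommutativeRing using (AlmostCommutativeRing; fromCommutativeRing)
open import Algebra.Properties.Group ℚP.+-0-group using (x∙y⁻¹≈ε⇒x≈y)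

open import Defs

-- The sum over the corners c of the shape (e + t, e) of f(shape) ⊕ f(shape with c removed),
-- where f takes a shape (e + t, e) by its parameters t and e.
module _ {A : Set} (_⊕_ : A → A → A) (ε : A) where

  cornerSum : (ℕ → ℕ → A) → ℕ → ℕ → A
  cornerSum f zero    zero    = ε
  cornerSum f (suc t) zero    = f (suc t) 0 ⊕ f t 0
  cornerSum f zero    (suc a) = f 0 (suc a) ⊕ f 1 a
  cornerSum f (suc t) (suc a) = (f (suc t) (suc a) ⊕ f t (suc a)) ⊕ (f (suc t) (suc a) ⊕ f (suc (suc t)) a)

module RationalArithmetic where

  open ℤ using (+_)
  open import Data.Rational using (_/_; toℚᵘ; _+_; _*_; _-_)
  open ℚP using (toℚᵘ-injective; toℚᵘ-fromℚᵘ; toℚᵘ-homo-+; toℚᵘ-homo-*; +-*-commutativeRing;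
                 *-zeroˡ; *-zeroʳ; *-identityˡ; *-identityʳ; +-identityˡ; +-identityʳ; +-assoc; +-inverseʳ; +-comm)

  ℚ-ring : AlmostCommutativeRing 0ℓ 0ℓ
  ℚ-ring = fromCommutativeRing +-*-commutativeRing is-zero?
    where
    is-zero? : ∀ x → Maybe (0ℚ ≡ x)
    is-zero? x with 0ℚ ℚP.≟ x
    ... | yes p = just p
    ... | no _  = nothing

  ι : ℕ → ℚ
  ι k = + k / 1

  -- 1/k, with the junk value 0 at k = 0.
  recip : ℕ → ℚ
  recip = frac (+ 1)

  private
    toℚᵘ-/ : ∀ i k → toℚᵘ (i / suc k) ℚᵘ.≃ ℚᵘ.mkℚᵘ i k
    toℚᵘ-/ i k = toℚᵘ-fromℚᵘ (ℚᵘ.mkℚᵘ i k)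

  ι-+ : ∀ a b → ι (a ℕ.+ b) ≡ ι a + ι b
  ι-+ a b = toℚᵘ-injective (begin
    toℚᵘ (ι (a ℕ.+ b))                    ≈⟨ toℚᵘ-/ (+ (a ℕ.+ b)) 0 ⟩
    ℚᵘ.mkℚᵘ (+ (a ℕ.+ b)) 0               ≈⟨ ℚᵘ.*≡* (cong (ℤ._* + 1) sum) ⟩
    ℚᵘ.mkℚᵘ (+ a) 0 ℚᵘ.+ ℚᵘ.mkℚᵘ (+ b) 0  ≈⟨ ℚᵘP.+-cong (toℚᵘ-/ (+ a) 0) (toℚᵘ-/ (+ b) 0) ⟨
    toℚᵘ (ι a) ℚᵘ.+ toℚᵘ (ι b)            ≈⟨ toℚᵘ-homo-+ (ι a) (ι b) ⟨
    toℚᵘ (ι a + ι b)                      ∎)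
    where
    open SetoidReasoning ℚᵘP.≃-setoid
    sum : + (a ℕ.+ b) ≡ + a ℤ.* + 1 ℤ.+ + b ℤ.* + 1
    sum = trans (ℤP.pos-+ a b) (sym (cong₂ ℤ._+_ (ℤP.*-identityʳ (+ a)) (ℤP.*-identityʳ (+ b))))

  ι-* : ∀ a b → ι (a ℕ.* b) ≡ ι a * ι b
  ι-* a b = toℚᵘ-injective (begin
    toℚᵘ (ι (a ℕ.* b))                    ≈⟨ toℚᵘ-/ (+ (a ℕ.* b)) 0 ⟩
    ℚᵘ.mkℚᵘ (+ (a ℕ.* b)) 0               ≈⟨ ℚᵘ.*≡* (cong (ℤ._* + 1) (ℤP.pos-* a b)) ⟩
    ℚᵘ.mkℚᵘ (+ a) 0 ℚᵘ.* ℚᵘ.mkℚᵘ (+ b) 0  ≈⟨ ℚᵘP.*-cong (toℚᵘ-/ (+ a) 0) (toℚᵘ-/ (+ b) 0) ⟨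
    toℚᵘ (ι a) ℚᵘ.* toℚᵘ (ι b)            ≈⟨ toℚᵘ-homo-* (ι a) (ι b) ⟨
    toℚᵘ (ι a * ι b)                      ∎)
    where open SetoidReasoning ℚᵘP.≃-setoid

  ι-+-cong : ∀ x y {p q} → ι x ≡ p → ι y ≡ q → ι (x ℕ.+ y) ≡ p + q
  ι-+-cong x y ιx≡p ιy≡q = trans (ι-+ x y) (cong₂ _+_ ιx≡p ιy≡q)

  ι-suc : ∀ k → ι (suc k) ≡ 1ℚ + ι k
  ι-suc = ι-+ 1

  ι-suc-expand : ∀ k {x} → ι k ≡ x → ι (suc k) ≡ x + 1ℚ
  ι-suc-expand k {x} ιk≡x = trans (ι-suc k) (trans (cong (_+_ 1ℚ) ιk≡x) (+-comm 1ℚ x))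

  frac≡/1*recip : ∀ i k → frac i k ≡ i / 1 * recip k
  frac≡/1*recip i zero    = sym (*-zeroʳ (i / 1))
  frac≡/1*recip i (suc k) = toℚᵘ-injective (begin
    toℚᵘ (i / suc k)                         ≈⟨ toℚᵘ-/ i k ⟩
    ℚᵘ.mkℚᵘ i k                              ≈⟨ ℚᵘ.*≡* split ⟩
    ℚᵘ.mkℚᵘ i 0 ℚᵘ.* ℚᵘ.mkℚᵘ (+ 1) k         ≈⟨ ℚᵘP.*-cong (toℚᵘ-/ i 0) (toℚᵘ-/ (+ 1) k) ⟨
    toℚᵘ (i / 1) ℚᵘ.* toℚᵘ (recip (suc k))   ≈⟨ toℚᵘ-homo-* (i / 1) (recip (suc k)) ⟨
    toℚᵘ (i / 1 * recip (suc k))             ∎)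
    where
    open SetoidReasoning ℚᵘP.≃-setoid
    split : i ℤ.* + suc (k ℕ.+ 0) ≡ i ℤ.* + 1 ℤ.* + suc k
    split = trans (cong (λ j → i ℤ.* + suc j) (ℕP.+-identityʳ k)) (cong (ℤ._* + suc k) (sym (ℤP.*-identityʳ i)))

  ι*recip : ∀ k → ι (suc k) * recip (suc k) ≡ 1ℚ
  ι*recip k = toℚᵘ-injective (begin
    toℚᵘ (ι (suc k) * recip (suc k))
      ≈⟨ toℚᵘ-homo-* (ι (suc k)) (recip (suc k)) ⟩
    toℚᵘ (ι (suc k)) ℚᵘ.* toℚᵘ (recip (suc k))
      ≈⟨ ℚᵘP.*-cong (toℚᵘ-/ (+ suc k) 0) (toℚᵘ-/ (+ 1) k) ⟩
    ℚᵘ.mkℚᵘ (+ suc k) 0 ℚᵘ.* ℚᵘ.mkℚᵘ (+ 1) k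
      ≈⟨ ℚᵘ.*≡* cancel ⟩
    ℚᵘ.mkℚᵘ (+ 1) 0 ∎)
    where
    open SetoidReasoning ℚᵘP.≃-setoid
    cancel : (+ suc k ℤ.* + 1) ℤ.* + 1 ≡ + 1 ℤ.* + suc (k ℕ.+ 0)
    cancel = trans (ℤP.*-identityʳ _) (trans (ℤP.*-identityʳ _)
               (trans (cong (λ j → + suc j) (sym (ℕP.+-identityʳ k))) (sym (ℤP.*-identityˡ _))))

  ι*recip-pos : ∀ {k} → 0 ℕ.< k → ι k * recip k ≡ 1ℚ
  ι*recip-pos {suc k} _ = ι*recip k

  recip-inverse : ∀ {k x} k′ → k ≡ suc k′ → ι k ≡ x → x * recip k ≡ 1ℚ
  recip-inverse k′ refl ιk≡x = trans (cong (_* recip (suc k′)) (sym ιk≡x)) (ι*recip k′)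

  recip-* : ∀ j k → recip (j ℕ.* k) ≡ recip j * recip k
  recip-* zero    k       = sym (*-zeroˡ (recip k))
  recip-* (suc j) zero    = trans (cong recip (ℕP.*-zeroʳ j)) (sym (*-zeroʳ (recip (suc j))))
  recip-* (suc j) (suc k) = inverse-unique {ι (suc j ℕ.* suc k)} (ι*recip (k ℕ.+ j ℕ.* suc k)) (begin
    ι (suc j ℕ.* suc k) * (recip (suc j) * recip (suc k))
      ≡⟨ cong (_* (recip (suc j) * recip (suc k))) (ι-* (suc j) (suc k)) ⟩
    ι (suc j) * ι (suc k) * (recip (suc j) * recip (suc k))
      ≡⟨ interchange (ι (suc j)) (ι (suc k)) (recip (suc j)) (recip (suc k)) ⟩
    (ι (suc j) * recip (suc j)) * (ι (suc k) * recip (suc k))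
      ≡⟨ cong₂ _*_ (ι*recip j) (ι*recip k) ⟩
    1ℚ ∎)
    where
    open ≡-Reasoning
    interchange : ∀ x y z w → x * y * (z * w) ≡ (x * z) * (y * w)
    interchange = solve-∀ ℚ-ring
    inverse-unique : ∀ {x y z} → x * y ≡ 1ℚ → x * z ≡ 1ℚ → y ≡ z
    inverse-unique {x} {y} {z} xy≡1 xz≡1 = begin
      y            ≡⟨ *-identityʳ y ⟨
      y * 1ℚ       ≡⟨ cong (y *_) xz≡1 ⟨
      y * (x * z)  ≡⟨ rearrange x y z ⟩
      x * y * z    ≡⟨ cong (_* z) xy≡1 ⟩
      1ℚ * z       ≡⟨ *-identityˡ z ⟩
      z            ∎
      where
      rearrange : ∀ x y z → y * (x * z) ≡ x * y * z
      rearrange = solve-∀ ℚ-ring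

  +[m+n]-+m≡+n : ∀ m n → + (m ℕ.+ n) ℤ.- + m ≡ + n
  +[m+n]-+m≡+n m n = trans (cong (ℤ._- + m) (ℤP.pos-+ m n)) (cancel (+ m) (+ n))
    where
    cancel : ∀ x y → x ℤ.+ y ℤ.- x ≡ y
    cancel = solve-∀ ℤ-Solver.ring

  -- The factor 1/(d+e) − x/((d+e+t+1)(d+e+t)) of the paper's summand, with k = d + e and s = d + e + t.
  summandFactor : ℕ → ℚ → ℕ → ℚ
  summandFactor k x s = recip k - x * (recip (suc s) * recip s)

  infixr 5 _◃_
  _◃_ : ℚ → (ℕ → ℚ) → ℕ → ℚ
  (x ◃ f) zero    = x
  (x ◃ f) (suc d) = f d

  sumBelow : ℕ → (ℕ → ℚ) → ℚ
  sumBelow L f = sumℚ (applyUpTo f L)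

  sumBelow-cong : ∀ L {f g : ℕ → ℚ} → (∀ d → f d ≡ g d) → sumBelow L f ≡ sumBelow L g
  sumBelow-cong zero    f≗g = refl
  sumBelow-cong (suc L) f≗g = cong₂ _+_ (f≗g 0) (sumBelow-cong L (f≗g ∘ suc))

  sumBelow-zero : ∀ L {f : ℕ → ℚ} → (∀ d → f d ≡ 0ℚ) → sumBelow L f ≡ 0ℚ
  sumBelow-zero zero    f≗0 = refl
  sumBelow-zero (suc L) f≗0 = trans (cong₂ _+_ (f≗0 0) (sumBelow-zero L (f≗0 ∘ suc))) (+-identityˡ 0ℚ)

  sumBelow-+ : ∀ L (f g : ℕ → ℚ) → sumBelow L (λ d → f d + g d) ≡ sumBelow L f + sumBelow L g
  sumBelow-+ zero    f g = refl
  sumBelow-+ (suc L) f g = trans (cong (_+_ (f 0 + g 0)) (sumBelow-+ L (f ∘ suc) (g ∘ suc)))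
                                 (interchange (f 0) (g 0) (sumBelow L (f ∘ suc)) (sumBelow L (g ∘ suc)))
    where
    interchange : ∀ x y z w → x + y + (z + w) ≡ x + z + (y + w)
    interchange = solve-∀ ℚ-ring

  sumBelow-suc : ∀ L (f : ℕ → ℚ) → sumBelow (suc L) f ≡ sumBelow L f + f L
  sumBelow-suc zero    f = trans (+-identityʳ (f 0)) (sym (+-identityˡ (f 0)))
  sumBelow-suc (suc L) f =
    trans (cong (_+_ (f 0)) (sumBelow-suc L (f ∘ suc))) (sym (+-assoc (f 0) (sumBelow L (f ∘ suc)) (f (suc L))))

  sumBelow-telescope : ∀ L (h : ℕ → ℚ) → sumBelow L (λ d → h d - h (suc d)) ≡ h 0 - h L
  sumBelow-telescope zero    h = sym (+-inverseʳ (h 0))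
  sumBelow-telescope (suc L) h =
    trans (cong (_+_ (h 0 - h 1)) (sumBelow-telescope L (h ∘ suc))) (collapse (h 0) (h 1) (h (suc L)))
    where
    collapse : ∀ x y z → x - y + (y - z) ≡ x - z
    collapse = solve-∀ ℚ-ring

  -- In both identities c is a multinomial coefficient, M, D, A, B stand for m, d, a, a + t, and
  -- u, ia, r₀, r₁, r₂ for the reciprocals of d + a + 1, d + a, d + a + t, d + a + t + 1, d + a + t + 2;
  -- in square-identity t = 0, so B = A and r₁ = u.
  pascal-identity : ∀ {c M D A B u ia r₀ r₁ r₂} →
    (D + A + 1ℚ) * u ≡ 1ℚ → (D + B) * r₀ ≡ 1ℚ → (D + B + 1ℚ + 1ℚ) * r₂ ≡ 1ℚ →
    (M + D + A + B + 1ℚ) * c * (u - (M + A) * (r₂ * r₁)) ≡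
      M * c * (u - (M - 1ℚ + A) * (r₂ * r₁)) + B * c * (u - (M + A) * (r₁ * r₀))
      + A * c * (ia - (M + A - 1ℚ) * (r₂ * r₁)) + c * (1ℚ - A * ia - D * (M + A) * (r₁ * r₀))
  pascal-identity {c} {M} {D} {A} {B} {u} {ia} {r₀} {r₁} {r₂} hu h₀ h₂ = x∙y⁻¹≈ε⇒x≈y _ _ (begin
    _ ≡⟨ difference c M D A B u ia r₀ r₁ r₂ ⟩
    c * (((D + A + 1ℚ) * u - 1ℚ) - (M + A) * r₁ * (((D + B + 1ℚ + 1ℚ) * r₂ - 1ℚ) - ((D + B) * r₀ - 1ℚ)))
      ≡⟨ cong₂ (λ x y → c * ((x - 1ℚ) - (M + A) * r₁ * y)) hu (cong₂ (λ x y → (x - 1ℚ) - (y - 1ℚ)) h₂ h₀) ⟩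
    c * (0ℚ - (M + A) * r₁ * (0ℚ - 0ℚ))
      ≡⟨ vanish c ((M + A) * r₁) ⟩
    0ℚ ∎)
    where
    open ≡-Reasoning
    difference : ∀ c M D A B u ia r₀ r₁ r₂ →
      (M + D + A + B + 1ℚ) * c * (u - (M + A) * (r₂ * r₁)) -
        (M * c * (u - (M - 1ℚ + A) * (r₂ * r₁)) + B * c * (u - (M + A) * (r₁ * r₀))
         + A * c * (ia - (M + A - 1ℚ) * (r₂ * r₁)) + c * (1ℚ - A * ia - D * (M + A) * (r₁ * r₀)))
      ≡ c * (((D + A + 1ℚ) * u - 1ℚ) - (M + A) * r₁ * (((D + B + 1ℚ + 1ℚ) * r₂ - 1ℚ) - ((D + B) * r₀ - 1ℚ)))
    difference = solve-∀ ℚ-ring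
    vanish : ∀ c x → c * (0ℚ - x * (0ℚ - 0ℚ)) ≡ 0ℚ
    vanish = solve-∀ ℚ-ring

  square-identity : ∀ {c M D A u ia r₂} →
    (D + A + 1ℚ) * u ≡ 1ℚ → (D + A + 1ℚ + 1ℚ) * r₂ ≡ 1ℚ →
    (M + D + A + A + 1ℚ) * c * (u - (M + A) * (r₂ * u)) ≡
      M * c * (u - (M - 1ℚ + A) * (r₂ * u)) + A * c * (ia - (M + A - 1ℚ) * (r₂ * u))
      + (c * (1ℚ - A * ia) - M * c * u)
  square-identity {c} {M} {D} {A} {u} {ia} {r₂} hu h₂ = x∙y⁻¹≈ε⇒x≈y _ _ (begin
    _ ≡⟨ difference c M D A u ia r₂ ⟩
    c * (((D + A + 1ℚ) * u - 1ℚ) - (M + A) * u * ((D + A + 1ℚ + 1ℚ) * r₂ - 1ℚ))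
      ≡⟨ cong₂ (λ x y → c * ((x - 1ℚ) - (M + A) * u * (y - 1ℚ))) hu h₂ ⟩
    c * (0ℚ - (M + A) * u * 0ℚ)
      ≡⟨ vanish c ((M + A) * u) ⟩
    0ℚ ∎)
    where
    open ≡-Reasoning
    difference : ∀ c M D A u ia r₂ →
      (M + D + A + A + 1ℚ) * c * (u - (M + A) * (r₂ * u)) -
        (M * c * (u - (M - 1ℚ + A) * (r₂ * u)) + A * c * (ia - (M + A - 1ℚ) * (r₂ * u))
         + (c * (1ℚ - A * ia) - M * c * u))
      ≡ c * (((D + A + 1ℚ) * u - 1ℚ) - (M + A) * u * ((D + A + 1ℚ + 1ℚ) * r₂ - 1ℚ))
    difference = solve-∀ ℚ-ring
    vanish : ∀ c x → c * (0ℚ - x * 0ℚ) ≡ 0ℚ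
    vanish = solve-∀ ℚ-ring

open RationalArithmetic
open import Data.Nat using (_+_; _*_; _∸_; _≤_; _≰_; _<_; _≤ᵇ_; _≤?_; z≤n; s≤s; s≤s⁻¹)

-- Counting tableaux by their largest entry

∑ : {A : Set} → (A → ℕ) → List A → ℕ
∑ f []       = 0
∑ f (x ∷ xs) = f x + ∑ f xs

indicator : {P : Set} → Dec P → ℕ
indicator (yes _) = 1
indicator (no _)  = 0

length-filter≡∑ : {A : Set} {P : A → Set} (P? : Decidable P) (xs : List A) →
  length (filter P? xs) ≡ ∑ (indicator ∘ P?) xs
length-filter≡∑ P? []       = refl
length-filter≡∑ P? (x ∷ xs) with P? x
... | yes _ = cong suc (length-filter≡∑ P? xs)
... | no  _ = length-filter≡∑ P? xs

∑-++ : {A : Set} (f : A → ℕ) (xs ys : List A) → ∑ f (xs ++ ys) ≡ ∑ f xs + ∑ f ys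
∑-++ f []       ys = refl
∑-++ f (x ∷ xs) ys = trans (cong (f x +_) (∑-++ f xs ys)) (sym (ℕP.+-assoc (f x) (∑ f xs) (∑ f ys)))

∑-cong : {A : Set} {f g : A → ℕ} (xs : List A) → (∀ {x} → x ∈ xs → f x ≡ g x) → ∑ f xs ≡ ∑ g xs
∑-cong []       f≗g = refl
∑-cong (x ∷ xs) f≗g = cong₂ _+_ (f≗g (here refl)) (∑-cong xs (f≗g ∘ there))

∑-zero : {A : Set} (f : A → ℕ) (xs : List A) → (∀ {x} → x ∈ xs → f x ≡ 0) → ∑ f xs ≡ 0
∑-zero f []       f≗0 = refl
∑-zero f (x ∷ xs) f≗0 = cong₂ _+_ (f≗0 (here refl)) (∑-zero f xs (f≗0 ∘ there))

∑-+ : {A : Set} (f g : A → ℕ) (xs : List A) → ∑ (λ x → f x + g x) xs ≡ ∑ f xs + ∑ g xs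
∑-+ f g []       = refl
∑-+ f g (x ∷ xs) = trans (cong (f x + g x +_) (∑-+ f g xs)) (interchange (f x) (g x) (∑ f xs) (∑ g xs))
  where
  interchange : ∀ a b c d → a + b + (c + d) ≡ a + c + (b + d)
  interchange = solve-∀ ℕ-Solver.ring

∑-*ˡ : {A : Set} (c : ℕ) (f : A → ℕ) (xs : List A) → ∑ (λ x → c * f x) xs ≡ c * ∑ f xs
∑-*ˡ c f []       = sym (ℕP.*-zeroʳ c)
∑-*ˡ c f (x ∷ xs) = trans (cong (c * f x +_) (∑-*ˡ c f xs)) (sym (ℕP.*-distribˡ-+ c (f x) (∑ f xs)))

∑-filter : {A : Set} {R : A → Set} (R? : Decidable R) (f : A → ℕ) (xs : List A) →
  (∀ x → ¬ R x → f x ≡ 0) → ∑ f (filter R? xs) ≡ ∑ f xs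
∑-filter R? f []       f≗0 = refl
∑-filter R? f (x ∷ xs) f≗0 with R? x
... | yes _  = cong (f x +_) (∑-filter R? f xs f≗0)
... | no ¬Rx = trans (∑-filter R? f xs f≗0) (cong (_+ ∑ f xs) (sym (f≗0 x ¬Rx)))

∑-map : {A B : Set} (f : B → ℕ) (g : A → B) (xs : List A) → ∑ f (map g xs) ≡ ∑ (f ∘ g) xs
∑-map f g []       = refl
∑-map f g (x ∷ xs) = cong (f (g x) +_) (∑-map f g xs)

∑-concatMap : {A B : Set} (f : B → ℕ) (g : A → List B) (xs : List A) → ∑ f (concatMap g xs) ≡ ∑ (∑ f ∘ g) xs
∑-concatMap f g []       = refl
∑-concatMap f g (x ∷ xs) = trans (∑-++ f (g x) (concatMap g xs)) (cong (∑ f (g x) +_) (∑-concatMap f g xs))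

∑-comm : {A B : Set} (F : A → B → ℕ) (xs : List A) (ys : List B) →
  ∑ (λ x → ∑ (F x) ys) xs ≡ ∑ (λ y → ∑ (λ x → F x y) xs) ys
∑-comm F []       ys = sym (∑-zero (λ _ → 0) ys (λ _ → refl))
∑-comm F (x ∷ xs) ys =
  trans (cong (∑ (F x) ys +_) (∑-comm F xs ys)) (sym (∑-+ (F x) (λ y → ∑ (λ x → F x y) xs) ys))

∑-allVecs-∷ʳ : {A : Set} (xs : List A) (n : ℕ) (f : Vec A (suc n) → ℕ) →
  ∑ f (allVecs (suc n) xs) ≡ ∑ (λ v → ∑ (λ x → f (v ∷ʳ x)) xs) (allVecs n xs)
∑-allVecs-∷ʳ xs zero    f =
  trans (∑-concatMap f _ xs) (trans (∑-cong xs (λ _ → ℕP.+-identityʳ _)) (sym (ℕP.+-identityʳ _)))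
∑-allVecs-∷ʳ xs (suc n) f = begin
  ∑ f (allVecs (suc (suc n)) xs)
    ≡⟨ ∑-concatMap f (λ y → map (y Vec.∷_) (allVecs (suc n) xs)) xs ⟩
  ∑ (λ y → ∑ f (map (y Vec.∷_) (allVecs (suc n) xs))) xs
    ≡⟨ ∑-cong xs (λ {y} _ → trans (∑-map f (y Vec.∷_) (allVecs (suc n) xs))
                                  (∑-allVecs-∷ʳ xs n (f ∘ (y Vec.∷_)))) ⟩
  ∑ (λ y → ∑ (g ∘ (y Vec.∷_)) (allVecs n xs)) xs
    ≡⟨ ∑-cong xs (λ {y} _ → sym (∑-map g (y Vec.∷_) (allVecs n xs))) ⟩
  ∑ (λ y → ∑ g (map (y Vec.∷_) (allVecs n xs))) xs
    ≡⟨ ∑-concatMap g (λ y → map (y Vec.∷_) (allVecs n xs)) xs ⟨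
  ∑ g (allVecs (suc n) xs) ∎
  where
  open ≡-Reasoning
  g : Vec _ (suc n) → ℕ
  g v = ∑ (λ x → f (v ∷ʳ x)) xs

∑-allVecs-restrict : {A : Set} {R : A → Set} (R? : Decidable R) (xs : List A) (n : ℕ) (f : Vec A n → ℕ) →
  (∀ v → f v ≢ 0 → ∀ i → R (lookup v i)) → ∑ f (allVecs n (filter R? xs)) ≡ ∑ f (allVecs n xs)
∑-allVecs-restrict R? xs zero    f f≢0⇒R = refl
∑-allVecs-restrict {R = R} R? xs (suc n) f f≢0⇒R = begin
  ∑ f (allVecs (suc n) (filter R? xs))
    ≡⟨ ∑-concatMap f _ (filter R? xs) ⟩
  ∑ (λ y → ∑ f (map (y Vec.∷_) (allVecs n (filter R? xs)))) (filter R? xs)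
    ≡⟨ ∑-cong (filter R? xs) (λ {y} _ → trans (∑-map f (y Vec.∷_) (allVecs n (filter R? xs)))
         (∑-allVecs-restrict R? xs n (f ∘ (y Vec.∷_)) (λ v fyv≢0 i → f≢0⇒R (y Vec.∷ v) fyv≢0 (Fin.suc i)))) ⟩
  ∑ (λ y → ∑ (f ∘ (y Vec.∷_)) (allVecs n xs)) (filter R? xs)
    ≡⟨ ∑-filter R? (λ y → ∑ (f ∘ (y Vec.∷_)) (allVecs n xs)) xs vanish ⟩
  ∑ (λ y → ∑ (f ∘ (y Vec.∷_)) (allVecs n xs)) xs
    ≡⟨ ∑-cong xs (λ {y} _ → sym (∑-map f (y Vec.∷_) (allVecs n xs))) ⟩
  ∑ (λ y → ∑ f (map (y Vec.∷_) (allVecs n xs))) xs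
    ≡⟨ ∑-concatMap f _ xs ⟨
  ∑ f (allVecs (suc n) xs) ∎
  where
  open ≡-Reasoning
  vanish : ∀ y → ¬ R y → ∑ (f ∘ (y Vec.∷_)) (allVecs n xs) ≡ 0
  vanish y ¬Ry = ∑-zero _ (allVecs n xs) (λ {v} _ → f≡0 v)
    where
    f≡0 : ∀ v → f (y Vec.∷ v) ≡ 0
    f≡0 v with f (y Vec.∷ v) ℕP.≟ 0
    ... | yes f≡0 = f≡0
    ... | no  f≢0 = ⊥-elim (¬Ry (f≢0⇒R (y Vec.∷ v) f≢0 Fin.zero))

-- IsSVT λ₁ λ₂ is IsSVTOn (shapeCells λ₁ λ₂), hence numSVT λ₁ λ₂ is numSVTOn (shapeCells λ₁ λ₂)
-- by definition.
IsSVTOn : List Cell → (n : ℕ) → Vec Cell n → Set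
IsSVTOn cs n v =
    (∀ a → lookup v a ∈ cs)
  × All (λ c → ∃ λ a → lookup v a ≡ c) cs
  × (∀ a b → lookup v a ≢ lookup v b → lookup v a ≼ lookup v b → a <ᶠ b)

isSVTOn? : (cs : List Cell) (n : ℕ) (v : Vec Cell n) → Dec (IsSVTOn cs n v)
isSVTOn? cs n v =
  all? (λ a → ∈?-gen _≟ᶜ_ (lookup v a) cs)
  ×-dec All.all? (λ c → any? (λ a → lookup v a ≟ᶜ c)) cs
  ×-dec all? (λ a → all? (λ b →
          ¬? (lookup v a ≟ᶜ lookup v b) →-dec
          ((proj₁ (lookup v a) ≤? proj₁ (lookup v b) ×-dec proj₂ (lookup v a) ≤? proj₂ (lookup v b))
            →-dec (a <ᶠ? b))))

numSVTOn : List Cell → ℕ → ℕ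
numSVTOn cs n = length (filter (isSVTOn? cs n) (allVecs n cs))

_≼?_ : ∀ c d → Dec (c ≼ d)
(i , j) ≼? (i′ , j′) = (i ≤? i′) ×-dec (j ≤? j′)

IsCorner : List Cell → Cell → Set
IsCorner cs x = All (λ c → x ≼ c → c ≡ x) cs

isCorner? : ∀ cs x → Dec (IsCorner cs x)
isCorner? cs x = All.all? (λ c → (x ≼? c) →-dec (c ≟ᶜ x)) cs

_∖_ : List Cell → Cell → List Cell
cs ∖ x = filter (λ c → ¬? (c ≟ᶜ x)) cs

lookup-∷ʳ-inject₁ : ∀ {A : Set} {n} (v : Vec A n) x i → lookup (v ∷ʳ x) (inject₁ i) ≡ lookup v i
lookup-∷ʳ-inject₁ (y Vec.∷ v) x Fin.zero    = refl
lookup-∷ʳ-inject₁ (y Vec.∷ v) x (Fin.suc i) = lookup-∷ʳ-inject₁ v x i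

lookup-∷ʳ-fromℕ : ∀ {A : Set} {n} (v : Vec A n) x → lookup (v ∷ʳ x) (fromℕ n) ≡ x
lookup-∷ʳ-fromℕ Vec.[]       x = refl
lookup-∷ʳ-fromℕ (y Vec.∷ v) x = lookup-∷ʳ-fromℕ v x

inject₁<fromℕ : ∀ {n} (i : Fin n) → inject₁ i <ᶠ fromℕ n
inject₁<fromℕ {n} i = subst₂ _<_ (sym (toℕ-inject₁ i)) (sym (toℕ-fromℕ n)) (toℕ<n i)

fromℕ≮inject₁ : ∀ {n} (i : Fin n) → ¬ (fromℕ n <ᶠ inject₁ i)
fromℕ≮inject₁ {n} i lt = ℕP.<-asym (subst₂ _<_ (toℕ-fromℕ n) (toℕ-inject₁ i) lt) (toℕ<n i)

inject₁-<-cancel : ∀ {n} (i j : Fin n) → inject₁ i <ᶠ inject₁ j → i <ᶠ j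
inject₁-<-cancel i j = subst₂ _<_ (toℕ-inject₁ i) (toℕ-inject₁ j)

inject₁-<-mono : ∀ {n} (i j : Fin n) → i <ᶠ j → inject₁ i <ᶠ inject₁ j
inject₁-<-mono i j = subst₂ _<_ (sym (toℕ-inject₁ i)) (sym (toℕ-inject₁ j))

module _ (cs : List Cell) {n : ℕ} (v : Vec Cell n) (x : Cell) where

  private
    w : Vec Cell (suc n)
    w = v ∷ʳ x

    Ordered : ∀ {k} → Vec Cell k → Set
    Ordered u = ∀ a b → lookup u a ≢ lookup u b → lookup u a ≼ lookup u b → a <ᶠ b

    ordered-init : Ordered w → Ordered v
    ordered-init ord i j ≢ ≼ = inject₁-<-cancel i j (ord (inject₁ i) (inject₁ j)
      (subst₂ _≢_ (sym (lookup-∷ʳ-inject₁ v x i)) (sym (lookup-∷ʳ-inject₁ v x j)) ≢)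
      (subst₂ _≼_ (sym (lookup-∷ʳ-inject₁ v x i)) (sym (lookup-∷ʳ-inject₁ v x j)) ≼))

    entries-init : (∀ a → lookup w a ∈ cs) → ∀ i → lookup v i ∈ cs
    entries-init ∈cs i = subst (_∈ cs) (lookup-∷ʳ-inject₁ v x i) (∈cs (inject₁ i))

  SVT-∷ʳ⇒corner : IsSVTOn cs (suc n) w → IsCorner cs x
  SVT-∷ʳ⇒corner (_ , filled , ord) = All.map corner filled
    where
    corner : ∀ {c} → (∃ λ a → lookup w a ≡ c) → x ≼ c → c ≡ x
    corner {c} (a , wa≡c) x≼c with c ≟ᶜ x | view a
    ... | yes c≡x | _          = c≡x
    ... | no  c≢x | ‵fromℕ     = ⊥-elim (c≢x (trans (sym wa≡c) (lookup-∷ʳ-fromℕ v x)))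
    ... | no  c≢x | ‵inject₁ i = ⊥-elim (fromℕ≮inject₁ i (ord (fromℕ n) (inject₁ i)
      (λ x≡wa → c≢x (trans (sym wa≡c) (trans (sym x≡wa) (lookup-∷ʳ-fromℕ v x))))
      (subst₂ _≼_ (sym (lookup-∷ʳ-fromℕ v x)) (sym wa≡c) x≼c)))

  SVT-∷ʳ⇒ : IsSVTOn cs (suc n) w → IsSVTOn cs n v ⊎ IsSVTOn (cs ∖ x) n v
  SVT-∷ʳ⇒ (∈cs , filled , ord) with any? (λ i → lookup v i ≟ᶜ x)
  ... | yes (i , vi≡x) = inj₁ (entries-init ∈cs , All.map refill filled , ordered-init ord)
    where
    refill : ∀ {c} → (∃ λ a → lookup w a ≡ c) → ∃ λ a → lookup v a ≡ c
    refill (a , wa≡c) with view a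
    ... | ‵fromℕ     = i , trans vi≡x (trans (sym (lookup-∷ʳ-fromℕ v x)) wa≡c)
    ... | ‵inject₁ j = j , trans (sym (lookup-∷ʳ-inject₁ v x j)) wa≡c
  ... | no ¬x∈v = inj₂ (removed , All.tabulate refill , ordered-init ord)
    where
    removed : ∀ i → lookup v i ∈ cs ∖ x
    removed i = ∈-filter⁺ (λ c → ¬? (c ≟ᶜ x)) (entries-init ∈cs i) (λ vi≡x → ¬x∈v (i , vi≡x))
    refill : ∀ {c} → c ∈ cs ∖ x → ∃ λ a → lookup v a ≡ c
    refill c∈ with ∈-filter⁻ (λ c → ¬? (c ≟ᶜ x)) c∈
    ... | c∈cs , c≢x with All.lookup filled c∈cs
    ...   | a , wa≡c with view a
    ...     | ‵fromℕ     = ⊥-elim (c≢x (trans (sym wa≡c) (lookup-∷ʳ-fromℕ v x)))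
    ...     | ‵inject₁ j = j , trans (sym (lookup-∷ʳ-inject₁ v x j)) wa≡c

  ⇒SVT-∷ʳ : x ∈ cs → IsCorner cs x → IsSVTOn cs n v ⊎ IsSVTOn (cs ∖ x) n v → IsSVTOn cs (suc n) w
  ⇒SVT-∷ʳ x∈cs corner svt = entries , All.tabulate (filled svt) , ordered
    where
    v∈cs : ∀ i → lookup v i ∈ cs
    v∈cs = entries-of svt
      where
      entries-of : IsSVTOn cs n v ⊎ IsSVTOn (cs ∖ x) n v → ∀ i → lookup v i ∈ cs
      entries-of (inj₁ (∈cs , _ , _))   i = ∈cs i
      entries-of (inj₂ (∈cs∖x , _ , _)) i = proj₁ (∈-filter⁻ (λ c → ¬? (c ≟ᶜ x)) (∈cs∖x i))
    ordered-v : Ordered v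
    ordered-v = ordered-of svt
      where
      ordered-of : IsSVTOn cs n v ⊎ IsSVTOn (cs ∖ x) n v → Ordered v
      ordered-of (inj₁ (_ , _ , ord)) = ord
      ordered-of (inj₂ (_ , _ , ord)) = ord
    entries : ∀ a → lookup w a ∈ cs
    entries a with view a
    ... | ‵fromℕ     = subst (_∈ cs) (sym (lookup-∷ʳ-fromℕ v x)) x∈cs
    ... | ‵inject₁ i = subst (_∈ cs) (sym (lookup-∷ʳ-inject₁ v x i)) (v∈cs i)
    via-v : ∀ {c} → (∃ λ i → lookup v i ≡ c) → ∃ λ a → lookup w a ≡ c
    via-v (i , vi≡c) = inject₁ i , trans (lookup-∷ʳ-inject₁ v x i) vi≡c
    filled : IsSVTOn cs n v ⊎ IsSVTOn (cs ∖ x) n v → ∀ {c} → c ∈ cs → ∃ λ a → lookup w a ≡ c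
    filled (inj₁ (_ , filledᵥ , _)) c∈cs = via-v (All.lookup filledᵥ c∈cs)
    filled (inj₂ (_ , filledᵥ , _)) {c} c∈cs with c ≟ᶜ x
    ... | yes c≡x = fromℕ n , trans (lookup-∷ʳ-fromℕ v x) (sym c≡x)
    ... | no  c≢x = via-v (All.lookup filledᵥ (∈-filter⁺ (λ c → ¬? (c ≟ᶜ x)) c∈cs c≢x))
    ordered : Ordered w
    ordered a b wa≢wb wa≼wb with view a | view b
    ... | ‵fromℕ     | ‵fromℕ     = ⊥-elim (wa≢wb refl)
    ... | ‵inject₁ i | ‵fromℕ     = inject₁<fromℕ i
    ... | ‵fromℕ     | ‵inject₁ j =
      ⊥-elim (wa≢wb (trans (lookup-∷ʳ-fromℕ v x) (trans (sym vj≡x) (sym (lookup-∷ʳ-inject₁ v x j)))))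
      where
      vj≡x : lookup v j ≡ x
      vj≡x = All.lookup corner (v∈cs j) (subst₂ _≼_ (lookup-∷ʳ-fromℕ v x) (lookup-∷ʳ-inject₁ v x j) wa≼wb)
    ... | ‵inject₁ i | ‵inject₁ j = inject₁-<-mono i j (ordered-v i j
      (subst₂ _≢_ (lookup-∷ʳ-inject₁ v x i) (lookup-∷ʳ-inject₁ v x j) wa≢wb)
      (subst₂ _≼_ (lookup-∷ʳ-inject₁ v x i) (lookup-∷ʳ-inject₁ v x j) wa≼wb))

  SVT-disjoint : x ∈ cs → IsSVTOn cs n v → ¬ IsSVTOn (cs ∖ x) n v
  SVT-disjoint x∈cs (_ , filled , _) (∈cs∖x , _ , _) with All.lookup filled x∈cs
  ... | i , vi≡x = proj₂ (∈-filter⁻ (λ c → ¬? (c ≟ᶜ x)) {xs = cs} (∈cs∖x i)) vi≡x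

  indicator-SVT-∷ʳ : x ∈ cs → indicator (isSVTOn? cs (suc n) w) ≡
    indicator (isCorner? cs x) * (indicator (isSVTOn? cs n v) + indicator (isSVTOn? (cs ∖ x) n v))
  indicator-SVT-∷ʳ x∈cs with isSVTOn? cs (suc n) w | isCorner? cs x | isSVTOn? cs n v | isSVTOn? (cs ∖ x) n v
  ... | yes svt | no ¬corner | _       | _       = ⊥-elim (¬corner (SVT-∷ʳ⇒corner svt))
  ... | yes _   | yes _      | yes s₁  | yes s₂  = ⊥-elim (SVT-disjoint x∈cs s₁ s₂)
  ... | yes _   | yes _      | yes _   | no _    = refl
  ... | yes _   | yes _      | no _    | yes _   = refl
  ... | yes svt | yes _      | no ¬s₁  | no ¬s₂  = ⊥-elim ([ ¬s₁ , ¬s₂ ]′ (SVT-∷ʳ⇒ svt))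
  ... | no _    | no _       | _       | _       = refl
  ... | no ¬svt | yes corner | yes s₁  | _       = ⊥-elim (¬svt (⇒SVT-∷ʳ x∈cs corner (inj₁ s₁)))
  ... | no ¬svt | yes corner | no _    | yes s₂  = ⊥-elim (¬svt (⇒SVT-∷ʳ x∈cs corner (inj₂ s₂)))
  ... | no _    | yes _      | no _    | no _    = refl

numSVTOn-suc : ∀ cs n →
  numSVTOn cs (suc n) ≡ ∑ (λ x → indicator (isCorner? cs x) * (numSVTOn cs n + numSVTOn (cs ∖ x) n)) cs
numSVTOn-suc cs n = begin
  numSVTOn cs (suc n)
    ≡⟨ length-filter≡∑ (isSVTOn? cs (suc n)) (allVecs (suc n) cs) ⟩
  ∑ (indicator ∘ isSVTOn? cs (suc n)) (allVecs (suc n) cs)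
    ≡⟨ ∑-allVecs-∷ʳ cs n (indicator ∘ isSVTOn? cs (suc n)) ⟩
  ∑ (λ v → ∑ (λ x → [SVT v ∷ʳ x ]) cs) (allVecs n cs)
    ≡⟨ ∑-comm (λ v x → [SVT v ∷ʳ x ]) (allVecs n cs) cs ⟩
  ∑ (λ x → ∑ (λ v → [SVT v ∷ʳ x ]) (allVecs n cs)) cs
    ≡⟨ ∑-cong cs (λ {x} → count-with-last x) ⟩
  ∑ (λ x → indicator (isCorner? cs x) * (numSVTOn cs n + numSVTOn (cs ∖ x) n)) cs ∎
  where
  open ≡-Reasoning
  [SVT_∷ʳ_] : Vec Cell n → Cell → ℕ
  [SVT v ∷ʳ x ] = indicator (isSVTOn? cs (suc n) (v ∷ʳ x))
  count-with-last : ∀ x → x ∈ cs →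
    ∑ (λ v → [SVT v ∷ʳ x ]) (allVecs n cs) ≡ indicator (isCorner? cs x) * (numSVTOn cs n + numSVTOn (cs ∖ x) n)
  count-with-last x x∈cs = begin
    ∑ (λ v → [SVT v ∷ʳ x ]) (allVecs n cs)
      ≡⟨ ∑-cong (allVecs n cs) (λ {v} _ → indicator-SVT-∷ʳ cs v x x∈cs) ⟩
    ∑ (λ v → corner * (svt v + svt∖x v)) (allVecs n cs)
      ≡⟨ ∑-*ˡ corner (λ v → svt v + svt∖x v) (allVecs n cs) ⟩
    corner * ∑ (λ v → svt v + svt∖x v) (allVecs n cs)
      ≡⟨ cong (corner *_) (∑-+ svt svt∖x (allVecs n cs)) ⟩
    corner * (∑ svt (allVecs n cs) + ∑ svt∖x (allVecs n cs))
      ≡⟨ cong₂ (λ p q → corner * (p + q)) (length-filter≡∑ (isSVTOn? cs n) (allVecs n cs))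
           (trans (length-filter≡∑ (isSVTOn? (cs ∖ x) n) (allVecs n (cs ∖ x)))
                  (∑-allVecs-restrict (λ c → ¬? (c ≟ᶜ x)) cs n svt∖x entries-differ)) ⟨
    corner * (numSVTOn cs n + numSVTOn (cs ∖ x) n) ∎
    where
    corner = indicator (isCorner? cs x)
    svt svt∖x : Vec Cell n → ℕ
    svt v = indicator (isSVTOn? cs n v)
    svt∖x v = indicator (isSVTOn? (cs ∖ x) n v)
    entries-differ : ∀ v → svt∖x v ≢ 0 → ∀ i → lookup v i ≢ x
    entries-differ v ≢0 i with isSVTOn? (cs ∖ x) n v
    ... | yes (∈cs∖x , _ , _) = proj₂ (∈-filter⁻ (λ c → ¬? (c ≟ᶜ x)) {xs = cs} (∈cs∖x i))
    ... | no _ = ⊥-elim (≢0 refl)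

row : ℕ → ℕ → List Cell
row r k = map (λ j → (r , suc j)) (upTo k)

row-∷ʳ : ∀ r k → row r (suc k) ≡ row r k ++ [ (r , suc k) ]
row-∷ʳ r k =
  trans (cong (map (λ j → (r , suc j))) (sym (ListP.upTo-∷ʳ k))) (ListP.map-++ (λ j → (r , suc j)) (upTo k) [ k ])

∈-row⁻ : ∀ {c r k} → c ∈ row r k → ∃ λ j → j < k × c ≡ (r , suc j)
∈-row⁻ c∈ with ∈-map⁻ (λ j → (_ , suc j)) c∈
... | j , j∈ , refl = j , ∈-upTo⁻ j∈ , refl

∈-row₁ : ∀ {j} l₁ l₂ → j < l₁ → (1 , suc j) ∈ shapeCells l₁ l₂
∈-row₁ l₁ l₂ j<l₁ = ∈-++⁺ˡ (∈-map⁺ (λ j → (1 , suc j)) (∈-upTo⁺ j<l₁))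

∈-row₂ : ∀ {j} l₁ l₂ → j < l₂ → (2 , suc j) ∈ shapeCells l₁ l₂
∈-row₂ l₁ l₂ j<l₂ = ∈-++⁺ʳ (row 1 l₁) (∈-map⁺ (λ j → (2 , suc j)) (∈-upTo⁺ j<l₂))

not-corner : ∀ {cs x c} → c ∈ cs → x ≼ c → c ≢ x → ¬ IsCorner cs x
not-corner c∈cs x≼c c≢x corner = c≢x (All.lookup corner c∈cs x≼c)

indicator-yes : {P : Set} (P? : Dec P) → P → indicator P? ≡ 1
indicator-yes (yes _) _ = refl
indicator-yes (no ¬p) p = ⊥-elim (¬p p)

indicator-no : {P : Set} (P? : Dec P) → ¬ P → indicator P? ≡ 0
indicator-no (yes p) ¬p = ⊥-elim (¬p p)
indicator-no (no _)  _  = refl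

∑-row-corners : ∀ cs r k (g : Cell → ℕ) → (∀ {j} → j < k → (r , suc (suc j)) ∈ cs) →
  ∑ (λ x → indicator (isCorner? cs x) * g x) (row r (suc k)) ≡ indicator (isCorner? cs (r , suc k)) * g (r , suc k)
∑-row-corners cs r k g next∈cs = begin
  ∑ F (row r (suc k))                  ≡⟨ cong (∑ F) (row-∷ʳ r k) ⟩
  ∑ F (row r k ++ [ (r , suc k) ])     ≡⟨ ∑-++ F (row r k) [ (r , suc k) ] ⟩
  ∑ F (row r k) + (F (r , suc k) + 0)  ≡⟨ cong₂ _+_ (∑-zero F (row r k) earlier) (ℕP.+-identityʳ (F (r , suc k))) ⟩
  F (r , suc k)                        ∎
  where
  open ≡-Reasoning
  F : Cell → ℕ
  F x = indicator (isCorner? cs x) * g x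
  earlier : ∀ {x} → x ∈ row r k → F x ≡ 0
  earlier x∈ with ∈-row⁻ x∈
  ... | j , j<k , refl = cong (_* g (r , suc j)) (indicator-no (isCorner? cs (r , suc j))
        (not-corner (next∈cs j<k) (ℕP.≤-refl , ℕP.n≤1+n (suc j))
                    (λ eq → ℕP.1+n≢n (ℕP.suc-injective (cong proj₂ eq)))))

corner-row₁ : ∀ k l₂ → l₂ ≤ k → IsCorner (shapeCells (suc k) l₂) (1 , suc k)
corner-row₁ k l₂ l₂≤k = All.tabulate below
  where
  below : ∀ {c} → c ∈ shapeCells (suc k) l₂ → (1 , suc k) ≼ c → c ≡ (1 , suc k)
  below c∈ (_ , suc-k≤) with ∈-++⁻ (row 1 (suc k)) c∈
  ... | inj₁ c∈row₁ with ∈-row⁻ c∈row₁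
  ...   | j , j<suc-k , refl = cong (λ j → (1 , j)) (ℕP.≤-antisym j<suc-k suc-k≤)
  below c∈ (_ , suc-k≤) | inj₂ c∈row₂ with ∈-row⁻ c∈row₂
  ...   | j , j<l₂ , refl =
    ⊥-elim (ℕP.<-irrefl refl (ℕP.<-≤-trans j<l₂ (ℕP.≤-trans l₂≤k (s≤s⁻¹ suc-k≤))))

not-corner-row₁ : ∀ k l → k ≤ l → ¬ IsCorner (shapeCells (suc k) (suc l)) (1 , suc k)
not-corner-row₁ k l k≤l = not-corner (∈-row₂ (suc k) (suc l) ℕP.≤-refl) (s≤s z≤n , s≤s k≤l) (λ ())

corner-row₂ : ∀ l₁ k → IsCorner (shapeCells l₁ (suc k)) (2 , suc k)
corner-row₂ l₁ k = All.tabulate below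
  where
  below : ∀ {c} → c ∈ shapeCells l₁ (suc k) → (2 , suc k) ≼ c → c ≡ (2 , suc k)
  below c∈ (2≤i , suc-k≤) with ∈-++⁻ (row 1 l₁) c∈
  ... | inj₁ c∈row₁ with ∈-row⁻ c∈row₁
  ...   | _ , _ , refl = ⊥-elim (ℕP.1+n≰n (s≤s⁻¹ 2≤i))
  below c∈ (_ , suc-k≤) | inj₂ c∈row₂ with ∈-row⁻ c∈row₂
  ...   | j , j<suc-k , refl = cong (λ j → (2 , j)) (ℕP.≤-antisym j<suc-k suc-k≤)

∖-keeps : ∀ x cs → All (_≢ x) cs → cs ∖ x ≡ cs
∖-keeps x cs = ListP.filter-all (λ c → ¬? (c ≟ᶜ x))

row-∖-last : ∀ r k → row r (suc k) ∖ (r , suc k) ≡ row r k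
row-∖-last r k = begin
  row r (suc k) ∖ (r , suc k)
    ≡⟨ cong (_∖ (r , suc k)) (row-∷ʳ r k) ⟩
  (row r k ++ [ (r , suc k) ]) ∖ (r , suc k)
    ≡⟨ ListP.filter-++ (λ c → ¬? (c ≟ᶜ (r , suc k))) (row r k) [ (r , suc k) ] ⟩
  (row r k ∖ (r , suc k)) ++ ([ (r , suc k) ] ∖ (r , suc k))
    ≡⟨ cong₂ _++_ (∖-keeps _ (row r k) (All.tabulate earlier))
                  (ListP.filter-reject (λ c → ¬? (c ≟ᶜ (r , suc k))) (λ ¬≡ → ¬≡ refl)) ⟩
  row r k ++ []
    ≡⟨ ListP.++-identityʳ (row r k) ⟩
  row r k ∎
  where
  open ≡-Reasoning
  earlier : ∀ {c} → c ∈ row r k → c ≢ (r , suc k)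
  earlier c∈ eq with ∈-row⁻ c∈
  ... | j , j<k , refl = ℕP.<-irrefl (ℕP.suc-injective (cong proj₂ eq)) j<k

row-∖-other : ∀ r k x → r ≢ proj₁ x → row r k ∖ x ≡ row r k
row-∖-other r k x r≢ = ∖-keeps x (row r k) (All.tabulate other)
  where
  other : ∀ {c} → c ∈ row r k → c ≢ x
  other c∈ refl with ∈-row⁻ c∈
  ... | _ , _ , refl = r≢ refl

shape∖row₁ : ∀ k l₂ → shapeCells (suc k) l₂ ∖ (1 , suc k) ≡ shapeCells k l₂
shape∖row₁ k l₂ = trans (ListP.filter-++ (λ c → ¬? (c ≟ᶜ (1 , suc k))) (row 1 (suc k)) (row 2 l₂))
  (cong₂ _++_ (row-∖-last 1 k) (row-∖-other 2 l₂ (1 , suc k) (λ ())))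

shape∖row₂ : ∀ l₁ k → shapeCells l₁ (suc k) ∖ (2 , suc k) ≡ shapeCells l₁ k
shape∖row₂ l₁ k = trans (ListP.filter-++ (λ c → ¬? (c ≟ᶜ (2 , suc k))) (row 1 l₁) (row 2 (suc k)))
  (cong₂ _++_ (row-∖-other 1 l₁ (2 , suc k) (λ ())) (row-∖-last 2 k))

numSVT-suc : ∀ e t n → numSVT (e + t) e (suc n) ≡ cornerSum _+_ 0 (λ t e → numSVT (e + t) e n) t e
numSVT-suc zero    zero    n = numSVTOn-suc [] n
numSVT-suc zero    (suc t) n = begin
  numSVTOn cs (suc n)                  ≡⟨ numSVTOn-suc cs n ⟩
  ∑ F (row 1 (suc t) ++ [])            ≡⟨ ∑-++ F (row 1 (suc t)) [] ⟩
  ∑ F (row 1 (suc t)) + 0              ≡⟨ ℕP.+-identityʳ _ ⟩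
  ∑ F (row 1 (suc t))                  ≡⟨ ∑-row-corners cs 1 t g (∈-row₁ (suc t) 0 ∘ s≤s) ⟩
  F (1 , suc t)
    ≡⟨ cong (_* g (1 , suc t)) (indicator-yes (isCorner? cs _) (corner-row₁ t 0 z≤n)) ⟩
  g (1 , suc t) + 0                    ≡⟨ ℕP.+-identityʳ _ ⟩
  numSVTOn cs n + numSVTOn (cs ∖ (1 , suc t)) n
    ≡⟨ cong (λ cs′ → numSVTOn cs n + numSVTOn cs′ n) (shape∖row₁ t 0) ⟩
  numSVT (suc t) 0 n + numSVT t 0 n ∎
  where
  open ≡-Reasoning
  cs = shapeCells (suc t) 0
  g : Cell → ℕ
  g x = numSVTOn cs n + numSVTOn (cs ∖ x) n
  F : Cell → ℕ
  F x = indicator (isCorner? cs x) * g x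
numSVT-suc (suc a) zero    n = begin
  numSVTOn cs (suc n)
    ≡⟨ numSVTOn-suc cs n ⟩
  ∑ F (row 1 (suc (a + 0)) ++ row 2 (suc a))
    ≡⟨ ∑-++ F (row 1 (suc (a + 0))) (row 2 (suc a)) ⟩
  ∑ F (row 1 (suc (a + 0))) + ∑ F (row 2 (suc a))
    ≡⟨ cong₂ _+_ (∑-row-corners cs 1 (a + 0) g (∈-row₁ (suc (a + 0)) (suc a) ∘ s≤s))
                 (∑-row-corners cs 2 a g (∈-row₂ (suc (a + 0)) (suc a) ∘ s≤s)) ⟩
  F (1 , suc (a + 0)) + F (2 , suc a)
    ≡⟨ cong₂ (λ p q → p * g (1 , suc (a + 0)) + q * g (2 , suc a))
         (indicator-no (isCorner? cs _) (not-corner-row₁ (a + 0) a (ℕP.≤-reflexive (ℕP.+-identityʳ a))))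
         (indicator-yes (isCorner? cs _) (corner-row₂ (suc (a + 0)) a)) ⟩
  g (2 , suc a) + 0
    ≡⟨ ℕP.+-identityʳ _ ⟩
  numSVTOn cs n + numSVTOn (cs ∖ (2 , suc a)) n
    ≡⟨ cong (λ cs′ → numSVTOn cs n + numSVTOn cs′ n) (shape∖row₂ (suc (a + 0)) a) ⟩
  numSVT (suc a + 0) (suc a) n + numSVT (suc a + 0) a n
    ≡⟨ cong (λ l → numSVT (suc a + 0) (suc a) n + numSVT l a n) (sym (ℕP.+-suc a 0)) ⟩
  numSVT (suc a + 0) (suc a) n + numSVT (a + 1) a n ∎
  where
  open ≡-Reasoning
  cs = shapeCells (suc a + 0) (suc a)
  g : Cell → ℕ
  g x = numSVTOn cs n + numSVTOn (cs ∖ x) n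
  F : Cell → ℕ
  F x = indicator (isCorner? cs x) * g x
numSVT-suc (suc a) (suc t) n = begin
  numSVTOn cs (suc n)
    ≡⟨ numSVTOn-suc cs n ⟩
  ∑ F (row 1 (suc k) ++ row 2 (suc a))
    ≡⟨ ∑-++ F (row 1 (suc k)) (row 2 (suc a)) ⟩
  ∑ F (row 1 (suc k)) + ∑ F (row 2 (suc a))
    ≡⟨ cong₂ _+_ (∑-row-corners cs 1 k g (∈-row₁ (suc k) (suc a) ∘ s≤s))
                 (∑-row-corners cs 2 a g (∈-row₂ (suc k) (suc a) ∘ s≤s)) ⟩
  F (1 , suc k) + F (2 , suc a)
    ≡⟨ cong₂ (λ p q → p * g (1 , suc k) + q * g (2 , suc a))
         (indicator-yes (isCorner? cs _) (corner-row₁ k (suc a) suc-a≤k))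
         (indicator-yes (isCorner? cs _) (corner-row₂ (suc k) a)) ⟩
  (g (1 , suc k) + 0) + (g (2 , suc a) + 0)
    ≡⟨ cong₂ _+_ (ℕP.+-identityʳ (g (1 , suc k))) (ℕP.+-identityʳ (g (2 , suc a))) ⟩
  (N + numSVTOn (cs ∖ (1 , suc k)) n) + (N + numSVTOn (cs ∖ (2 , suc a)) n)
    ≡⟨ cong₂ (λ p q → (N + numSVTOn p n) + (N + numSVTOn q n)) (shape∖row₁ k (suc a)) (shape∖row₂ (suc k) a) ⟩
  (N + numSVT k (suc a) n) + (N + numSVT (suc k) a n)
    ≡⟨ cong₂ (λ l l′ → (N + numSVT l (suc a) n) + (N + numSVT l′ a n))
             (ℕP.+-suc a t) (sym (ℕP.+-suc a (suc t))) ⟩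
  (N + numSVT (suc a + t) (suc a) n) + (N + numSVT (a + suc (suc t)) a n) ∎
  where
  open ≡-Reasoning
  k = a + suc t
  cs = shapeCells (suc k) (suc a)
  N = numSVTOn cs n
  g : Cell → ℕ
  g x = N + numSVTOn (cs ∖ x) n
  F : Cell → ℕ
  F x = indicator (isCorner? cs x) * g x
  suc-a≤k : suc a ≤ k
  suc-a≤k = subst (suc a ≤_) (sym (ℕP.+-suc a t)) (s≤s (ℕP.m≤m+n a t))

numSVT-no-entries : ∀ l₁ l₂ → 0 < l₁ → numSVT l₁ l₂ 0 ≡ 0
numSVT-no-entries (suc l₁) l₂ _ = refl

-- The summands in coordinates

total : ℕ → ℕ → ℕ → ℕ → ℕ
total m d a b = m + d + a + b

multinomial : ℕ → ℕ → ℕ → ℕ → ℚ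
multinomial m d a b = ι (total m d a b !) ℚ.* recip (m ! * d ! * a ! * b !)

private
  multinomial-shift : ∀ {K P K′ P′} n k r → K ≡ suc n → P ≡ suc k ! * r → K′ ≡ n → P′ ≡ k ! * r →
    ι (suc k) ℚ.* (ι (K !) ℚ.* recip P) ≡ ι (suc n) ℚ.* (ι (K′ !) ℚ.* recip P′)
  multinomial-shift n k r refl refl refl refl = begin
    ι (suc k) ℚ.* (ι (suc n !) ℚ.* recip (suc k ! * r))
      ≡⟨ cong (λ P → ι (suc k) ℚ.* (ι (suc n !) ℚ.* recip P)) (ℕP.*-assoc (suc k) (k !) r) ⟩
    ι (suc k) ℚ.* (ι (suc n * n !) ℚ.* recip (suc k * (k ! * r)))
      ≡⟨ cong₂ (λ x y → ι (suc k) ℚ.* (x ℚ.* y)) (ι-* (suc n) (n !)) (recip-* (suc k) (k ! * r)) ⟩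
    ι (suc k) ℚ.* (ι (suc n) ℚ.* ι (n !) ℚ.* (recip (suc k) ℚ.* recip (k ! * r)))
      ≡⟨ rearrange (ι (suc k)) (ι (suc n)) (ι (n !)) (recip (suc k)) (recip (k ! * r)) ⟩
    ι (suc n) ℚ.* (ι (n !) ℚ.* recip (k ! * r)) ℚ.* (ι (suc k) ℚ.* recip (suc k))
      ≡⟨ cong (ι (suc n) ℚ.* (ι (n !) ℚ.* recip (k ! * r)) ℚ.*_) (ι*recip k) ⟩
    ι (suc n) ℚ.* (ι (n !) ℚ.* recip (k ! * r)) ℚ.* 1ℚ
      ≡⟨ ℚP.*-identityʳ _ ⟩
    ι (suc n) ℚ.* (ι (n !) ℚ.* recip (k ! * r)) ∎
    where
    open ≡-Reasoning
    rearrange : ∀ x y z u v → x ℚ.* (y ℚ.* z ℚ.* (u ℚ.* v)) ≡ y ℚ.* (z ℚ.* v) ℚ.* (x ℚ.* u)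
    rearrange = solve-∀ ℚ-ring

  slot₁ : ∀ x y z w → x * y * z * w ≡ x * (y * z * w)
  slot₁ = solve-∀ ℕ-Solver.ring
  slot₂ : ∀ x y z w → x * y * z * w ≡ y * (x * z * w)
  slot₂ = solve-∀ ℕ-Solver.ring
  slot₃ : ∀ x y z w → x * y * z * w ≡ z * (x * y * w)
  slot₃ = solve-∀ ℕ-Solver.ring
  slot₄ : ∀ x y z w → x * y * z * w ≡ w * (x * y * z)
  slot₄ = solve-∀ ℕ-Solver.ring

multinomial-suc₁ : ∀ m d a b →
  ι (suc m) ℚ.* multinomial (suc m) d a b ≡ ι (suc (total m d a b)) ℚ.* multinomial m d a b
multinomial-suc₁ m d a b = multinomial-shift (total m d a b) m _
  refl (slot₁ (suc m !) (d !) (a !) (b !)) refl (slot₁ (m !) (d !) (a !) (b !))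

multinomial-suc₂ : ∀ m d a b →
  ι (suc d) ℚ.* multinomial m (suc d) a b ≡ ι (suc (total m d a b)) ℚ.* multinomial m d a b
multinomial-suc₂ m d a b = multinomial-shift (total m d a b) d _
  (level m d a b) (slot₂ (m !) (suc d !) (a !) (b !)) refl (slot₂ (m !) (d !) (a !) (b !))
  where
  level : ∀ m d a b → m + suc d + a + b ≡ suc (m + d + a + b)
  level = solve-∀ ℕ-Solver.ring

multinomial-suc₃ : ∀ m d a b →
  ι (suc a) ℚ.* multinomial m d (suc a) b ≡ ι (suc (total m d a b)) ℚ.* multinomial m d a b
multinomial-suc₃ m d a b = multinomial-shift (total m d a b) a _
  (level m d a b) (slot₃ (m !) (d !) (suc a !) (b !)) refl (slot₃ (m !) (d !) (a !) (b !))
  where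
  level : ∀ m d a b → m + d + suc a + b ≡ suc (m + d + a + b)
  level = solve-∀ ℕ-Solver.ring

multinomial-suc₄ : ∀ m d a b →
  ι (suc b) ℚ.* multinomial m d a (suc b) ≡ ι (suc (total m d a b)) ℚ.* multinomial m d a b
multinomial-suc₄ m d a b = multinomial-shift (total m d a b) b _
  (ℕP.+-suc (m + d + a) b) (slot₄ (m !) (d !) (a !) (suc b !)) refl (slot₄ (m !) (d !) (a !) (b !))

ι-total : ∀ m d a b → ι (total m d a b) ≡ ι m ℚ.+ ι d ℚ.+ ι a ℚ.+ ι b
ι-total m d a b =
  trans (ι-+ (m + d + a) b) (cong (ℚ._+ ι b) (trans (ι-+ (m + d) a) (cong (ℚ._+ ι a) (ι-+ m d))))

summand-on : ∀ {n t a d} → d + 2 * suc a + t ≤ n →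
  summand n t (suc a) d ≡
    frac (ℤ.+ ((n ∸ 1) !)) ((n ∸ (d + 2 * suc a + t)) ! * d ! * a ! * (a + t) !) ℚ.*
    (recip (d + suc a) ℚ.- frac (ℤ.+ n ℤ.- ℤ.+ (d + suc a + t + 1)) ((d + suc a + t + 1) * (d + suc a + t)))
summand-on {n} {t} {a} {d} le with d + 2 * suc a + t ≤ᵇ n | ℕP.≤⇒≤ᵇ le
... | true | _ = refl

summand-off : ∀ n t e d → ¬ (d + 2 * e + t ≤ n) → summand n t e d ≡ 0ℚ
summand-off n t e d ¬le with d + 2 * e + t ≤ᵇ n in eq
... | true  = ⊥-elim (¬le (ℕP.≤ᵇ⇒≤ _ n (subst T (sym eq) tt)))
... | false = refl

summand-e0 : ∀ n t d → summand n t 0 d ≡ 0ℚ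
summand-e0 n t d with d + 2 * 0 + t ≤ᵇ n
... | true  = refl
... | false = refl

summand-beyond : ∀ n t e d → n < d → summand n t e d ≡ 0ℚ
summand-beyond n t e d n<d =
  summand-off n t e d (λ le → ℕP.<⇒≱ n<d (ℕP.m+n≤o⇒m≤o d (ℕP.m+n≤o⇒m≤o (d + 2 * e) le)))

-- With e = a + 1 and m = n − (d + 2e + t) the summand s(n, t, e, d) has n − 2 = total m d a (a + t),
-- and its prefactor (n − 1)!/(m! d! (e − 1)! (e + t − 1)!) is (n − 1) · multinomial m d a (a + t).
summand-coordinates : ∀ m d a t →
  summand (suc (suc (total m d a (a + t)))) t (suc a) d ≡
    ι (suc (total m d a (a + t))) ℚ.* multinomial m d a (a + t) ℚ.*
    summandFactor (suc (d + a)) (ι m ℚ.+ ι a) (suc (d + a + t))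
summand-coordinates m d a t = begin
  summand n t (suc a) d
    ≡⟨ summand-on {n} {t} {a} {d} (subst (d + 2 * suc a + t ≤_) (sym n≡) (ℕP.m≤m+n _ m)) ⟩
  frac (ℤ.+ (suc K !)) ((n ∸ (d + 2 * suc a + t)) ! * d ! * a ! * (a + t) !) ℚ.*
    (recip (d + suc a) ℚ.- frac (ℤ.+ n ℤ.- ℤ.+ (d + suc a + t + 1)) S)
    ≡⟨ cong₂ (λ k z → frac (ℤ.+ (suc K !)) (k ! * d ! * a ! * (a + t) !) ℚ.* (recip (d + suc a) ℚ.- frac z S))
         (trans (cong (_∸ (d + 2 * suc a + t)) n≡) (ℕP.m+n∸m≡n (d + 2 * suc a + t) m))
         (trans (cong (λ k → ℤ.+ k ℤ.- ℤ.+ (d + suc a + t + 1)) n≡′)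
                (+[m+n]-+m≡+n (d + suc a + t + 1) (m + a))) ⟩
  frac (ℤ.+ (suc K !)) P ℚ.* (recip (d + suc a) ℚ.- frac (ℤ.+ (m + a)) S)
    ≡⟨ cong₂ (λ x y → x ℚ.* (recip (d + suc a) ℚ.- y))
             (frac≡/1*recip (ℤ.+ (suc K !)) P) (frac≡/1*recip (ℤ.+ (m + a)) S) ⟩
  ι (suc K !) ℚ.* recip P ℚ.* (recip (d + suc a) ℚ.- ι (m + a) ℚ.* recip S)
    ≡⟨ cong₂ (λ x y → x ℚ.* recip P ℚ.* y) (ι-* (suc K) (K !)) factor ⟩
  ι (suc K) ℚ.* ι (K !) ℚ.* recip P ℚ.* summandFactor (suc (d + a)) (ι m ℚ.+ ι a) (suc (d + a + t))
    ≡⟨ cong (ℚ._* summandFactor (suc (d + a)) (ι m ℚ.+ ι a) (suc (d + a + t))) (ℚP.*-assoc (ι (suc K)) _ _) ⟩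
  ι (suc K) ℚ.* multinomial m d a (a + t) ℚ.* summandFactor (suc (d + a)) (ι m ℚ.+ ι a) (suc (d + a + t)) ∎
  where
  open ≡-Reasoning
  K = total m d a (a + t)
  n = suc (suc K)
  P = m ! * d ! * a ! * (a + t) !
  S = (d + suc a + t + 1) * (d + suc a + t)
  n≡ : n ≡ d + 2 * suc a + t + m
  n≡ = level m d a t
    where
    level : ∀ m d a t → suc (suc (m + d + a + (a + t))) ≡ d + 2 * suc a + t + m
    level = solve-∀ ℕ-Solver.ring
  n≡′ : n ≡ d + suc a + t + 1 + (m + a)
  n≡′ = level m d a t
    where
    level : ∀ m d a t → suc (suc (m + d + a + (a + t))) ≡ d + suc a + t + 1 + (m + a)
    level = solve-∀ ℕ-Solver.ring
  factor : recip (d + suc a) ℚ.- ι (m + a) ℚ.* recip S ≡ summandFactor (suc (d + a)) (ι m ℚ.+ ι a) (suc (d + a + t))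
  factor = begin
    recip (d + suc a) ℚ.- ι (m + a) ℚ.* recip ((d + suc a + t + 1) * (d + suc a + t))
      ≡⟨ cong₂ (λ x y → recip x ℚ.- ι (m + a) ℚ.* recip ((y + 1) * y))
               (ℕP.+-suc d a) (cong (_+ t) (ℕP.+-suc d a)) ⟩
    recip (suc (d + a)) ℚ.- ι (m + a) ℚ.* recip ((suc (d + a + t) + 1) * suc (d + a + t))
      ≡⟨ cong₂ (λ x y → recip (suc (d + a)) ℚ.- x ℚ.* recip (y * suc (d + a + t)))
               (ι-+ m a) (ℕP.+-comm (suc (d + a + t)) 1) ⟩
    recip (suc (d + a)) ℚ.- (ι m ℚ.+ ι a) ℚ.* recip (suc (suc (d + a + t)) * suc (d + a + t))
      ≡⟨ cong (λ x → recip (suc (d + a)) ℚ.- (ι m ℚ.+ ι a) ℚ.* x)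
              (recip-* (suc (suc (d + a + t))) (suc (d + a + t))) ⟩
    summandFactor (suc (d + a)) (ι m ℚ.+ ι a) (suc (d + a + t)) ∎

private
  0*x*y≡0 : ∀ x y → 0ℚ ℚ.* x ℚ.* y ≡ 0ℚ
  0*x*y≡0 = solve-∀ ℚ-ring

summand-same-shape : ∀ m d a t →
  summand (suc (total m d a (a + t))) t (suc a) d ≡
    ι m ℚ.* multinomial m d a (a + t) ℚ.* summandFactor (suc (d + a)) (ι m ℚ.- 1ℚ ℚ.+ ι a) (suc (d + a + t))
summand-same-shape zero d a t = trans (summand-off _ t (suc a) d out-of-range)
  (sym (0*x*y≡0 (multinomial 0 d a (a + t)) (summandFactor (suc (d + a)) (0ℚ ℚ.- 1ℚ ℚ.+ ι a) (suc (d + a + t)))))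
  where
  out-of-range : ¬ (d + 2 * suc a + t ≤ suc (total 0 d a (a + t)))
  out-of-range le = ℕP.1+n≰n (subst (_≤ suc (total 0 d a (a + t))) (level d a t) le)
    where
    level : ∀ d a t → d + 2 * suc a + t ≡ suc (suc (0 + d + a + (a + t)))
    level = solve-∀ ℕ-Solver.ring
summand-same-shape (suc m) d a t = begin
  summand (suc (suc (total m d a (a + t)))) t (suc a) d
    ≡⟨ summand-coordinates m d a t ⟩
  ι (suc (total m d a (a + t))) ℚ.* multinomial m d a (a + t) ℚ.* F (ι m ℚ.+ ι a)
    ≡⟨ cong₂ (λ c x → c ℚ.* F x) (sym (multinomial-suc₁ m d a (a + t)))
         (trans (cong (ℚ._+ ι a) (pred (ι m))) (cong (λ x → x ℚ.- 1ℚ ℚ.+ ι a) (sym (ι-suc m)))) ⟩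
  ι (suc m) ℚ.* multinomial (suc m) d a (a + t) ℚ.* F (ι (suc m) ℚ.- 1ℚ ℚ.+ ι a) ∎
  where
  open ≡-Reasoning
  F : ℚ → ℚ
  F x = summandFactor (suc (d + a)) x (suc (d + a + t))
  pred : ∀ x → x ≡ 1ℚ ℚ.+ x ℚ.- 1ℚ
  pred = solve-∀ ℚ-ring

summand-row₁-shortened : ∀ m d a t →
  summand (suc (total m d a (a + suc t))) t (suc a) d ≡
    ι (a + suc t) ℚ.* multinomial m d a (a + suc t) ℚ.* summandFactor (suc (d + a)) (ι m ℚ.+ ι a) (suc (d + a + t))
summand-row₁-shortened m d a t = begin
  summand (suc (total m d a (a + suc t))) t (suc a) d
    ≡⟨ cong (λ n → summand (suc n) t (suc a) d)
            (trans (cong (_+_ (m + d + a)) (ℕP.+-suc a t)) (ℕP.+-suc (m + d + a) (a + t))) ⟩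
  summand (suc (suc (total m d a (a + t)))) t (suc a) d
    ≡⟨ summand-coordinates m d a t ⟩
  ι (suc (total m d a (a + t))) ℚ.* multinomial m d a (a + t) ℚ.* F
    ≡⟨ cong (ℚ._* F) (sym (multinomial-suc₄ m d a (a + t))) ⟩
  ι (suc (a + t)) ℚ.* multinomial m d a (suc (a + t)) ℚ.* F
    ≡⟨ cong (λ b → ι b ℚ.* multinomial m d a b ℚ.* F) (sym (ℕP.+-suc a t)) ⟩
  ι (a + suc t) ℚ.* multinomial m d a (a + suc t) ℚ.* F ∎
  where
  open ≡-Reasoning
  F = summandFactor (suc (d + a)) (ι m ℚ.+ ι a) (suc (d + a + t))

summand-row₂-shortened : ∀ m d a t →
  summand (suc (total m d a (a + t))) (suc t) a d ≡
    ι a ℚ.* multinomial m d a (a + t) ℚ.* summandFactor (d + a) (ι m ℚ.+ ι a ℚ.- 1ℚ) (suc (d + a + t))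
summand-row₂-shortened m d zero    t = trans (summand-e0 _ (suc t) d)
  (sym (0*x*y≡0 (multinomial m d 0 t) (summandFactor (d + 0) (ι m ℚ.+ 0ℚ ℚ.- 1ℚ) (suc (d + 0 + t)))))
summand-row₂-shortened m d (suc a) t = begin
  summand (suc (total m d (suc a) (suc a + t))) (suc t) (suc a) d
    ≡⟨ cong (λ n → summand (suc n) (suc t) (suc a) d) (level m d a t) ⟩
  summand (suc (suc (total m d a (a + suc t)))) (suc t) (suc a) d
    ≡⟨ summand-coordinates m d a (suc t) ⟩
  ι (suc (total m d a (a + suc t))) ℚ.* multinomial m d a (a + suc t) ℚ.* F (suc (d + a)) (ι m ℚ.+ ι a) (d + a + suc t)
    ≡⟨ cong (ℚ._* F (suc (d + a)) (ι m ℚ.+ ι a) (d + a + suc t)) (sym (multinomial-suc₃ m d a (a + suc t))) ⟩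
  ι (suc a) ℚ.* multinomial m d (suc a) (a + suc t) ℚ.* F (suc (d + a)) (ι m ℚ.+ ι a) (d + a + suc t)
    ≡⟨ cong₂ (λ b k → ι (suc a) ℚ.* multinomial m d (suc a) b ℚ.* F k (ι m ℚ.+ ι a) (d + a + suc t))
         (ℕP.+-suc a t) (sym (ℕP.+-suc d a)) ⟩
  ι (suc a) ℚ.* multinomial m d (suc a) (suc a + t) ℚ.* F (d + suc a) (ι m ℚ.+ ι a) (d + a + suc t)
    ≡⟨ cong₂ (λ x s → ι (suc a) ℚ.* multinomial m d (suc a) (suc a + t) ℚ.* F (d + suc a) x s)
         (trans (pred (ι m) (ι a)) (cong (λ y → ι m ℚ.+ y ℚ.- 1ℚ) (sym (ι-suc a))))
         (trans (ℕP.+-suc (d + a) t) (cong (_+ t) (sym (ℕP.+-suc d a)))) ⟩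
  ι (suc a) ℚ.* multinomial m d (suc a) (suc a + t) ℚ.* F (d + suc a) (ι m ℚ.+ ι (suc a) ℚ.- 1ℚ) (d + suc a + t) ∎
  where
  open ≡-Reasoning
  F : ℕ → ℚ → ℕ → ℚ
  F k x s = summandFactor k x (suc s)
  level : ∀ m d a t → m + d + suc a + (suc a + t) ≡ suc (m + d + a + (a + suc t))
  level = solve-∀ ℕ-Solver.ring
  pred : ∀ x y → x ℚ.+ y ≡ x ℚ.+ (1ℚ ℚ.+ y) ℚ.- 1ℚ
  pred = solve-∀ ℚ-ring

summand-previous-d : ∀ m d a t →
  summand (suc (total m (suc d) a (a + t))) t (suc a) d ≡
    ι (suc d) ℚ.* multinomial m (suc d) a (a + t) ℚ.* summandFactor (suc d + a) (ι m ℚ.+ ι a) (suc (d + a + t))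
summand-previous-d m d a t = begin
  summand (suc (total m (suc d) a (a + t))) t (suc a) d
    ≡⟨ cong (λ n → summand (suc n) t (suc a) d) (level m d a (a + t)) ⟩
  summand (suc (suc (total m d a (a + t)))) t (suc a) d
    ≡⟨ summand-coordinates m d a t ⟩
  ι (suc (total m d a (a + t))) ℚ.* multinomial m d a (a + t) ℚ.* F
    ≡⟨ cong (ℚ._* F) (sym (multinomial-suc₂ m d a (a + t))) ⟩
  ι (suc d) ℚ.* multinomial m (suc d) a (a + t) ℚ.* F ∎
  where
  open ≡-Reasoning
  F = summandFactor (suc (d + a)) (ι m ℚ.+ ι a) (suc (d + a + t))
  level : ∀ m d a b → m + suc d + a + b ≡ suc (m + d + a + b)
  level = solve-∀ ℕ-Solver.ring

ι-binomial : ∀ n k → k ≤ n → ι (n C k) ≡ ι (n !) ℚ.* recip (k ! * (n ∸ k) !)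
ι-binomial n k k≤n = begin
  ι (n C k)                        ≡⟨ ℚP.*-identityʳ (ι (n C k)) ⟨
  ι (n C k) ℚ.* 1ℚ                 ≡⟨ cong (ι (n C k) ℚ.*_) (ι*recip-pos P>0) ⟨
  ι (n C k) ℚ.* (ι P ℚ.* recip P)  ≡⟨ ℚP.*-assoc (ι (n C k)) (ι P) (recip P) ⟨
  ι (n C k) ℚ.* ι P ℚ.* recip P    ≡⟨ cong (ℚ._* recip P) (ι-* (n C k) P) ⟨
  ι ((n C k) * P) ℚ.* recip P      ≡⟨ cong (λ x → ι x ℚ.* recip P) nCk*P≡n! ⟩
  ι (n !) ℚ.* recip P              ∎
  where
  open ≡-Reasoning
  P = k ! * (n ∸ k) !
  P>0 : 0 < P
  P>0 = ℕP.*-mono-≤ (ℕP.1≤n! k) (ℕP.1≤n! (n ∸ k))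
  nCk*P≡n! : (n C k) * P ≡ n !
  nCk*P≡n! = trans (cong (_* P) (nCk≡n!/k![n-k]! k≤n)) (m/n*n≡m {{ℕP._!*_!≢0 k (n ∸ k)}} (k![n∸k]!∣n! k≤n))

chiTerm-as-multinomial : ∀ m a t →
  chiTerm (suc (total m 0 a (a + t))) (suc t) a ≡ multinomial m 0 a (a + t) ℚ.* (1ℚ ℚ.- ι a ℚ.* recip a)
chiTerm-as-multinomial m zero t = begin
  ι (K C t)                              ≡⟨ ι-binomial K t t≤K ⟩
  ι (K !) ℚ.* recip (t ! * (K ∸ t) !)    ≡⟨ cong (λ x → ι (K !) ℚ.* recip x) reorder ⟩
  ι (K !) ℚ.* recip (m ! * 1 * 1 * t !)  ≡⟨ ℚP.*-identityʳ (multinomial m 0 0 t) ⟨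
  multinomial m 0 0 t ℚ.* 1ℚ             ∎
  where
  open ≡-Reasoning
  K = total m 0 0 (0 + t)
  K≡t+m : K ≡ t + m
  K≡t+m = trans (cong (_+ t) (trans (ℕP.+-identityʳ (m + 0)) (ℕP.+-identityʳ m))) (ℕP.+-comm m t)
  t≤K : t ≤ K
  t≤K = subst (t ≤_) (sym K≡t+m) (ℕP.m≤m+n t m)
  reorder : t ! * (K ∸ t) ! ≡ m ! * 1 * 1 * t !
  reorder = trans (cong (λ x → t ! * x !) (trans (cong (_∸ t) K≡t+m) (ℕP.m+n∸m≡n t m))) (swap (t !) (m !))
    where
    swap : ∀ x y → x * y ≡ y * 1 * 1 * x
    swap = solve-∀ ℕ-Solver.ring
chiTerm-as-multinomial m (suc a) t = sym (begin
  multinomial m 0 (suc a) (suc a + t) ℚ.* (1ℚ ℚ.- ι (suc a) ℚ.* recip (suc a))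
    ≡⟨ cong (λ x → multinomial m 0 (suc a) (suc a + t) ℚ.* (1ℚ ℚ.- x)) (ι*recip a) ⟩
  multinomial m 0 (suc a) (suc a + t) ℚ.* 0ℚ
    ≡⟨ ℚP.*-zeroʳ (multinomial m 0 (suc a) (suc a + t)) ⟩
  0ℚ ∎)
  where open ≡-Reasoning

-- As recip 0 = 0, the factor 1 − a · recip (d + a) is d/(d + a), except that it is 1 at d = a = 0;
-- this is what turns the d = 0 case into the boundary term χ(e = 1) binom(n − 1, t).
summand-previous-or-boundary : ∀ m d a t →
  (chiTerm (suc (total m d a (a + t))) (suc t) a ◃ summand (suc (total m d a (a + t))) t (suc a)) d ≡
    multinomial m d a (a + t) ℚ.*
      (1ℚ ℚ.- ι a ℚ.* recip (d + a)
          ℚ.- ι d ℚ.* (ι m ℚ.+ ι a) ℚ.* (recip (suc (d + a + t)) ℚ.* recip (d + a + t)))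
summand-previous-or-boundary m zero    a t = trans (chiTerm-as-multinomial m a t)
  (cong (multinomial m 0 a (a + t) ℚ.*_) (drop (1ℚ ℚ.- ι a ℚ.* recip a) (ι m ℚ.+ ι a) _))
  where
  drop : ∀ x y z → x ≡ x ℚ.- 0ℚ ℚ.* y ℚ.* z
  drop = solve-∀ ℚ-ring
summand-previous-or-boundary m (suc d) a t = trans (summand-previous-d m d a t)
  (absorb (multinomial m (suc d) a (a + t)) (ι (suc d)) (ι a) (recip (suc d + a)) (ι m ℚ.+ ι a)
          (recip (suc (suc d + a + t)) ℚ.* recip (suc d + a + t)) (recip-inverse (d + a) refl (ι-+ (suc d) a)))
  where
  absorb : ∀ c D A u x q → (D ℚ.+ A) ℚ.* u ≡ 1ℚ →
    D ℚ.* c ℚ.* (u ℚ.- x ℚ.* q) ≡ c ℚ.* (1ℚ ℚ.- A ℚ.* u ℚ.- D ℚ.* x ℚ.* q)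
  absorb c D A u x q h = trans (expand c D A u x q) (cong (λ y → c ℚ.* (y ℚ.- A ℚ.* u ℚ.- D ℚ.* x ℚ.* q)) h)
    where
    expand : ∀ c D A u x q →
      D ℚ.* c ℚ.* (u ℚ.- x ℚ.* q) ≡ c ℚ.* ((D ℚ.+ A) ℚ.* u ℚ.- A ℚ.* u ℚ.- D ℚ.* x ℚ.* q)
    expand = solve-∀ ℚ-ring

coordinates : ∀ {n} d a t → d + 2 * suc a + t ≤ suc (suc n) → ∃[ m ] n ≡ total m d a (a + t)
coordinates {n} d a t le with ℕP.m≤n⇒∃[o]m+o≡n le
... | m , eq = m , ℕP.suc-injective (ℕP.suc-injective (trans (sym eq) (level d a t m)))
  where
  level : ∀ d a t m → d + 2 * suc a + t + m ≡ suc (suc (m + d + a + (a + t)))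
  level = solve-∀ ℕ-Solver.ring

-- The recurrence for the formula

summand-pascal-at : ∀ m d a t → let K = total m d a (a + suc t) in
  summand (suc (suc K)) (suc t) (suc a) d ≡
    summand (suc K) (suc t) (suc a) d ℚ.+ summand (suc K) t (suc a) d ℚ.+ summand (suc K) (suc (suc t)) a d ℚ.+
    (chiTerm (suc K) (suc (suc t)) a ◃ summand (suc K) (suc t) (suc a)) d
summand-pascal-at m d a t = begin
  summand (suc (suc K)) (suc t) (suc a) d
    ≡⟨ summand-coordinates m d a (suc t) ⟩
  ι (suc K) ℚ.* c ℚ.* X₁
    ≡⟨ cong (λ k → k ℚ.* c ℚ.* X₁) (ι-suc-expand K (ι-total m d a (a + suc t))) ⟩
  (M ℚ.+ D ℚ.+ A ℚ.+ B ℚ.+ 1ℚ) ℚ.* c ℚ.* X₁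
    ≡⟨ pascal-identity {c} {M} {D} {A} {B} {u} {ia} {r₀} {r₁} {r₂} hu h₀ h₂ ⟩
  M ℚ.* c ℚ.* X₂ ℚ.+ B ℚ.* c ℚ.* X₃ ℚ.+ A ℚ.* c ℚ.* X₄ ℚ.+ c ℚ.* X₅
    ≡⟨ cong₂ ℚ._+_ (cong₂ ℚ._+_ (cong₂ ℚ._+_ (summand-same-shape m d a (suc t)) row₁)
                                (summand-row₂-shortened m d a (suc t)))
                   (summand-previous-or-boundary m d a (suc t)) ⟨
  summand (suc K) (suc t) (suc a) d ℚ.+ summand (suc K) t (suc a) d ℚ.+ summand (suc K) (suc (suc t)) a d ℚ.+
    (chiTerm (suc K) (suc (suc t)) a ◃ summand (suc K) (suc t) (suc a)) d ∎
  where
  open ≡-Reasoning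
  K = total m d a (a + suc t)
  c = multinomial m d a (a + suc t)
  M = ι m
  D = ι d
  A = ι a
  B = ι (a + suc t)
  u = recip (suc (d + a))
  ia = recip (d + a)
  r₀ = recip (d + a + suc t)
  r₁ = recip (suc (d + a + suc t))
  r₂ = recip (suc (suc (d + a + suc t)))
  X₁ = u ℚ.- (M ℚ.+ A) ℚ.* (r₂ ℚ.* r₁)
  X₂ = u ℚ.- (M ℚ.- 1ℚ ℚ.+ A) ℚ.* (r₂ ℚ.* r₁)
  X₃ = u ℚ.- (M ℚ.+ A) ℚ.* (r₁ ℚ.* r₀)
  X₄ = ia ℚ.- (M ℚ.+ A ℚ.- 1ℚ) ℚ.* (r₂ ℚ.* r₁)
  X₅ = 1ℚ ℚ.- A ℚ.* ia ℚ.- D ℚ.* (M ℚ.+ A) ℚ.* (r₁ ℚ.* r₀)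
  ι-d+a+suc-t : ι (d + a + suc t) ≡ D ℚ.+ B
  ι-d+a+suc-t = trans (cong ι (ℕP.+-assoc d a (suc t))) (ι-+ d (a + suc t))
  hu : (D ℚ.+ A ℚ.+ 1ℚ) ℚ.* u ≡ 1ℚ
  hu = recip-inverse (d + a) refl (ι-suc-expand (d + a) (ι-+ d a))
  h₀ : (D ℚ.+ B) ℚ.* r₀ ≡ 1ℚ
  h₀ = recip-inverse (d + a + t) (ℕP.+-suc (d + a) t) ι-d+a+suc-t
  h₂ : (D ℚ.+ B ℚ.+ 1ℚ ℚ.+ 1ℚ) ℚ.* r₂ ≡ 1ℚ
  h₂ = recip-inverse (suc (d + a + suc t)) refl
         (ι-suc-expand (suc (d + a + suc t)) (ι-suc-expand (d + a + suc t) ι-d+a+suc-t))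
  row₁ : summand (suc K) t (suc a) d ≡ B ℚ.* c ℚ.* X₃
  row₁ = trans (summand-row₁-shortened m d a t)
    (cong (λ s → B ℚ.* c ℚ.* (u ℚ.- (M ℚ.+ A) ℚ.* (recip (suc s) ℚ.* recip s)))
          (sym (ℕP.+-suc (d + a) t)))

summand-pascal : ∀ n t a d →
  summand (suc (suc n)) (suc t) (suc a) d ≡
    summand (suc n) (suc t) (suc a) d ℚ.+ summand (suc n) t (suc a) d ℚ.+ summand (suc n) (suc (suc t)) a d ℚ.+
    (chiTerm (suc n) (suc (suc t)) a ◃ summand (suc n) (suc t) (suc a)) d
summand-pascal n t a d with d + 2 * suc a + suc t ≤? suc (suc n)
... | yes le with coordinates d a (suc t) le
...   | m , refl = summand-pascal-at m d a t
summand-pascal n t a d | no ¬le = begin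
  summand (suc (suc n)) (suc t) (suc a) d ≡⟨ summand-off _ (suc t) (suc a) d ¬le ⟩
  0ℚ ℚ.+ 0ℚ ℚ.+ 0ℚ ℚ.+ 0ℚ
    ≡⟨ cong₂ ℚ._+_ (cong₂ ℚ._+_ (cong₂ ℚ._+_ same row₁) (row₂ a ¬le)) (previous a d ¬le) ⟨
  summand (suc n) (suc t) (suc a) d ℚ.+ summand (suc n) t (suc a) d ℚ.+ summand (suc n) (suc (suc t)) a d ℚ.+
    (chiTerm (suc n) (suc (suc t)) a ◃ summand (suc n) (suc t) (suc a)) d ∎
  where
  open ≡-Reasoning
  same : summand (suc n) (suc t) (suc a) d ≡ 0ℚ
  same = summand-off _ (suc t) (suc a) d (¬le ∘ ℕP.m≤n⇒m≤1+n)
  row₁ : summand (suc n) t (suc a) d ≡ 0ℚ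
  row₁ = summand-off _ t (suc a) d (λ le → ¬le (subst (_≤ suc (suc n)) (sym (ℕP.+-suc _ t)) (s≤s le)))
  row₂ : ∀ a → d + 2 * suc a + suc t ≰ suc (suc n) → summand (suc n) (suc (suc t)) a d ≡ 0ℚ
  row₂ zero    _ = summand-e0 _ (suc (suc t)) d
  row₂ (suc a) ¬le =
    summand-off _ (suc (suc t)) (suc a) d (λ le → ¬le (subst (_≤ suc (suc n)) (level d a t) (s≤s le)))
    where
    level : ∀ d a t → suc (d + 2 * suc a + suc (suc t)) ≡ d + 2 * suc (suc a) + suc t
    level = solve-∀ ℕ-Solver.ring
  previous : ∀ a d → d + 2 * suc a + suc t ≰ suc (suc n) →
    (chiTerm (suc n) (suc (suc t)) a ◃ summand (suc n) (suc t) (suc a)) d ≡ 0ℚ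
  previous zero    zero    ¬le = cong ι (k>n⇒nCk≡0 (s≤s⁻¹ (s≤s⁻¹ (ℕP.≰⇒> ¬le))))
  previous (suc a) zero    ¬le = refl
  previous a       (suc d) ¬le = summand-off _ (suc t) (suc a) d (λ le → ¬le (s≤s le))

squareCertificate : ℕ → ℕ → ℕ → ℚ
squareCertificate n zero    d = 0ℚ
squareCertificate n (suc a) d =
  if d + 2 * suc a ≤ᵇ n
  then multinomial (n ∸ (d + 2 * suc a)) d a a ℚ.* (1ℚ ℚ.- ι a ℚ.* recip (d + a))
  else 0ℚ

squareCertificate-on : ∀ {n a d} → d + 2 * suc a ≤ n →
  squareCertificate n (suc a) d ≡
    multinomial (n ∸ (d + 2 * suc a)) d a a ℚ.* (1ℚ ℚ.- ι a ℚ.* recip (d + a))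
squareCertificate-on {n} {a} {d} le with d + 2 * suc a ≤ᵇ n | ℕP.≤⇒≤ᵇ le
... | true | _ = refl

squareCertificate-off : ∀ n a d → ¬ (d + 2 * suc a ≤ n) → squareCertificate n (suc a) d ≡ 0ℚ
squareCertificate-off n a d ¬le with d + 2 * suc a ≤ᵇ n in eq
... | true  = ⊥-elim (¬le (ℕP.≤ᵇ⇒≤ _ n (subst T (sym eq) tt)))
... | false = refl

squareCertificate-at : ∀ m d a →
  squareCertificate (suc (suc (total m d a (a + 0)))) (suc a) d ≡
    multinomial m d a (a + 0) ℚ.* (1ℚ ℚ.- ι a ℚ.* recip (d + a))
squareCertificate-at m d a =
  trans (squareCertificate-on (subst (d + 2 * suc a ≤_) (sym n≡) (ℕP.m≤m+n _ m)))
        (cong₂ (λ k b → multinomial k d a b ℚ.* (1ℚ ℚ.- ι a ℚ.* recip (d + a)))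
               (trans (cong (_∸ (d + 2 * suc a)) n≡) (ℕP.m+n∸m≡n (d + 2 * suc a) m)) (sym (ℕP.+-identityʳ a)))
  where
  n≡ : suc (suc (total m d a (a + 0))) ≡ d + 2 * suc a + m
  n≡ = level m d a
    where
    level : ∀ m d a → suc (suc (m + d + a + (a + 0))) ≡ d + 2 * suc a + m
    level = solve-∀ ℕ-Solver.ring

squareCertificate-next : ∀ m d a →
  squareCertificate (suc (suc (total m d a (a + 0)))) (suc a) (suc d) ≡
    ι m ℚ.* multinomial m d a (a + 0) ℚ.* recip (suc (d + a))
squareCertificate-next zero    d a =
  trans (squareCertificate-off _ a (suc d) out-of-range)
        (sym (0*x*y≡0 (multinomial 0 d a (a + 0)) (recip (suc (d + a)))))
  where
  out-of-range : ¬ (suc d + 2 * suc a ≤ suc (suc (total 0 d a (a + 0))))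
  out-of-range le = ℕP.1+n≰n (subst (_≤ suc (suc (total 0 d a (a + 0)))) (level d a) le)
    where
    level : ∀ d a → suc d + 2 * suc a ≡ suc (suc (suc (0 + d + a + (a + 0))))
    level = solve-∀ ℕ-Solver.ring
squareCertificate-next (suc m) d a = begin
  squareCertificate (suc (suc (total (suc m) d a (a + 0)))) (suc a) (suc d)
    ≡⟨ cong (λ n → squareCertificate (suc (suc n)) (suc a) (suc d)) (level m d a (a + 0)) ⟩
  squareCertificate (suc (suc (total m (suc d) a (a + 0)))) (suc a) (suc d)
    ≡⟨ squareCertificate-at m (suc d) a ⟩
  c′ ℚ.* (1ℚ ℚ.- ι a ℚ.* recip (suc d + a))
    ≡⟨ cong (c′ ℚ.*_) (complement (ι (suc d)) (ι a) (recip (suc d + a))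
                                   (recip-inverse (d + a) refl (ι-+ (suc d) a))) ⟩
  c′ ℚ.* (ι (suc d) ℚ.* recip (suc (d + a)))
    ≡⟨ swap c′ (ι (suc d)) (recip (suc (d + a))) ⟩
  ι (suc d) ℚ.* c′ ℚ.* recip (suc (d + a))
    ≡⟨ cong (ℚ._* recip (suc (d + a)))
            (trans (multinomial-suc₂ m d a (a + 0)) (sym (multinomial-suc₁ m d a (a + 0)))) ⟩
  ι (suc m) ℚ.* multinomial (suc m) d a (a + 0) ℚ.* recip (suc (d + a)) ∎
  where
  open ≡-Reasoning
  c′ = multinomial m (suc d) a (a + 0)
  level : ∀ m d a b → suc m + d + a + b ≡ m + suc d + a + b
  level = solve-∀ ℕ-Solver.ring
  complement : ∀ D A u → (D ℚ.+ A) ℚ.* u ≡ 1ℚ → 1ℚ ℚ.- A ℚ.* u ≡ D ℚ.* u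
  complement D A u h = trans (cong (λ x → x ℚ.- A ℚ.* u) (sym h)) (cancel D A u)
    where
    cancel : ∀ D A u → (D ℚ.+ A) ℚ.* u ℚ.- A ℚ.* u ≡ D ℚ.* u
    cancel = solve-∀ ℚ-ring
  swap : ∀ x y z → x ℚ.* (y ℚ.* z) ≡ y ℚ.* x ℚ.* z
  swap = solve-∀ ℚ-ring

summand-square-at : ∀ m d a → let K = total m d a (a + 0) in
  summand (suc (suc K)) 0 (suc a) d ≡
    summand (suc K) 0 (suc a) d ℚ.+ summand (suc K) 1 a d ℚ.+
    (squareCertificate (suc (suc K)) (suc a) d ℚ.- squareCertificate (suc (suc K)) (suc a) (suc d))
summand-square-at m d a = begin
  summand (suc (suc K)) 0 (suc a) d
    ≡⟨ summand-coordinates m d a 0 ⟩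
  ι (suc K) ℚ.* c ℚ.* summandFactor (suc (d + a)) (M ℚ.+ A) (suc (d + a + 0))
    ≡⟨ cong₂ (λ k s → k ℚ.* c ℚ.* summandFactor (suc (d + a)) (M ℚ.+ A) (suc s))
             ι-suc-K (ℕP.+-identityʳ (d + a)) ⟩
  (M ℚ.+ D ℚ.+ A ℚ.+ A ℚ.+ 1ℚ) ℚ.* c ℚ.* X₁
    ≡⟨ square-identity {c} {M} {D} {A} {u} {ia} {r₂} hu h₂ ⟩
  M ℚ.* c ℚ.* X₂ ℚ.+ A ℚ.* c ℚ.* X₄ ℚ.+ (c ℚ.* (1ℚ ℚ.- A ℚ.* ia) ℚ.- M ℚ.* c ℚ.* u)
    ≡⟨ cong₂ ℚ._+_ (cong₂ ℚ._+_ same row₂)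
                   (cong₂ ℚ._-_ (squareCertificate-at m d a) (squareCertificate-next m d a)) ⟨
  summand (suc K) 0 (suc a) d ℚ.+ summand (suc K) 1 a d ℚ.+
    (squareCertificate (suc (suc K)) (suc a) d ℚ.- squareCertificate (suc (suc K)) (suc a) (suc d)) ∎
  where
  open ≡-Reasoning
  K = total m d a (a + 0)
  c = multinomial m d a (a + 0)
  M = ι m
  D = ι d
  A = ι a
  u = recip (suc (d + a))
  ia = recip (d + a)
  r₂ = recip (suc (suc (d + a)))
  X₁ = u ℚ.- (M ℚ.+ A) ℚ.* (r₂ ℚ.* u)
  X₂ = u ℚ.- (M ℚ.- 1ℚ ℚ.+ A) ℚ.* (r₂ ℚ.* u)
  X₄ = ia ℚ.- (M ℚ.+ A ℚ.- 1ℚ) ℚ.* (r₂ ℚ.* u)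
  ι-suc-K : ι (suc K) ≡ M ℚ.+ D ℚ.+ A ℚ.+ A ℚ.+ 1ℚ
  ι-suc-K = ι-suc-expand K
    (trans (ι-total m d a (a + 0)) (cong (λ b → M ℚ.+ D ℚ.+ A ℚ.+ ι b) (ℕP.+-identityʳ a)))
  hu : (D ℚ.+ A ℚ.+ 1ℚ) ℚ.* u ≡ 1ℚ
  hu = recip-inverse (d + a) refl (ι-suc-expand (d + a) (ι-+ d a))
  h₂ : (D ℚ.+ A ℚ.+ 1ℚ ℚ.+ 1ℚ) ℚ.* r₂ ≡ 1ℚ
  h₂ = recip-inverse (suc (d + a)) refl (ι-suc-expand (suc (d + a)) (ι-suc-expand (d + a) (ι-+ d a)))
  same : summand (suc K) 0 (suc a) d ≡ M ℚ.* c ℚ.* X₂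
  same = trans (summand-same-shape m d a 0)
    (cong (λ s → M ℚ.* c ℚ.* summandFactor (suc (d + a)) (M ℚ.- 1ℚ ℚ.+ A) (suc s))
          (ℕP.+-identityʳ (d + a)))
  row₂ : summand (suc K) 1 a d ≡ A ℚ.* c ℚ.* X₄
  row₂ = trans (summand-row₂-shortened m d a 0)
    (cong (λ s → A ℚ.* c ℚ.* summandFactor (d + a) (M ℚ.+ A ℚ.- 1ℚ) (suc s)) (ℕP.+-identityʳ (d + a)))

summand-square : ∀ n a d →
  summand (suc (suc n)) 0 (suc a) d ≡
    summand (suc n) 0 (suc a) d ℚ.+ summand (suc n) 1 a d ℚ.+
    (squareCertificate (suc (suc n)) (suc a) d ℚ.- squareCertificate (suc (suc n)) (suc a) (suc d))
summand-square n a d with d + 2 * suc a + 0 ≤? suc (suc n)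
... | yes le with coordinates d a 0 le
...   | m , refl = summand-square-at m d a
summand-square n a d | no ¬le = begin
  summand (suc (suc n)) 0 (suc a) d   ≡⟨ summand-off _ 0 (suc a) d ¬le ⟩
  0ℚ ℚ.+ 0ℚ ℚ.+ (0ℚ ℚ.- 0ℚ)
    ≡⟨ cong₂ ℚ._+_ (cong₂ ℚ._+_ same (row₂ a ¬le)) (cong₂ ℚ._-_ at-d at-suc-d) ⟨
  summand (suc n) 0 (suc a) d ℚ.+ summand (suc n) 1 a d ℚ.+
    (squareCertificate (suc (suc n)) (suc a) d ℚ.- squareCertificate (suc (suc n)) (suc a) (suc d)) ∎
  where
  open ≡-Reasoning
  ¬le′ : ¬ (d + 2 * suc a ≤ suc (suc n))
  ¬le′ le = ¬le (subst (_≤ suc (suc n)) (sym (ℕP.+-identityʳ _)) le)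
  same : summand (suc n) 0 (suc a) d ≡ 0ℚ
  same = summand-off _ 0 (suc a) d (¬le ∘ ℕP.m≤n⇒m≤1+n)
  row₂ : ∀ a → ¬ (d + 2 * suc a + 0 ≤ suc (suc n)) → summand (suc n) 1 a d ≡ 0ℚ
  row₂ zero    _   = summand-e0 _ 1 d
  row₂ (suc a) ¬le = summand-off _ 1 (suc a) d (λ le → ¬le (subst (_≤ suc (suc n)) (level d a) (s≤s le)))
    where
    level : ∀ d a → suc (d + 2 * suc a + 1) ≡ d + 2 * suc (suc a) + 0
    level = solve-∀ ℕ-Solver.ring
  at-d : squareCertificate (suc (suc n)) (suc a) d ≡ 0ℚ
  at-d = squareCertificate-off _ a d ¬le′
  at-suc-d : squareCertificate (suc (suc n)) (suc a) (suc d) ≡ 0ℚ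
  at-suc-d = squareCertificate-off _ a (suc d) (¬le′ ∘ ℕP.<⇒≤)

formula-sum : ∀ n t e → formula n t e ≡ chiTerm n t e ℚ.+ sumBelow (suc n) (summand n t e)
formula-sum n t e = cong (λ xs → chiTerm n t e ℚ.+ sumℚ xs) (ListP.map-upTo (summand n t e) (suc n))

formula-sum-extended : ∀ n t e → formula n t e ≡ chiTerm n t e ℚ.+ sumBelow (suc (suc n)) (summand n t e)
formula-sum-extended n t e = trans (formula-sum n t e) (cong (chiTerm n t e ℚ.+_) (sym (begin
  sumBelow (suc (suc n)) (summand n t e)                      ≡⟨ sumBelow-suc (suc n) (summand n t e) ⟩
  sumBelow (suc n) (summand n t e) ℚ.+ summand n t e (suc n)
    ≡⟨ cong (sumBelow (suc n) (summand n t e) ℚ.+_) (summand-beyond n t e (suc n) ℕP.≤-refl) ⟩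
  sumBelow (suc n) (summand n t e) ℚ.+ 0ℚ                     ≡⟨ ℚP.+-identityʳ _ ⟩
  sumBelow (suc n) (summand n t e)                            ∎)))
  where open ≡-Reasoning

formula-e0 : ∀ n t → formula n t 0 ≡ chiTerm n t 0
formula-e0 n t = trans (formula-sum n t 0)
  (trans (cong (chiTerm n t 0 ℚ.+_) (sumBelow-zero (suc n) (summand-e0 n t))) (ℚP.+-identityʳ (chiTerm n t 0)))

chiTerm-pascal : ∀ n t → chiTerm (suc (suc n)) (suc t) 0 ≡ chiTerm (suc n) (suc t) 0 ℚ.+ chiTerm (suc n) t 0
chiTerm-pascal n zero    = sym (ℚP.+-identityʳ _)
chiTerm-pascal n (suc t) = begin
  ι (suc n C suc t)                  ≡⟨ cong ι (nCk+nC[k+1]≡[n+1]C[k+1] n t) ⟨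
  ι (n C t + n C suc t)              ≡⟨ ι-+ (n C t) (n C suc t) ⟩
  ι (n C t) ℚ.+ ι (n C suc t)        ≡⟨ ℚP.+-comm (ι (n C t)) (ι (n C suc t)) ⟩
  ι (n C suc t) ℚ.+ ι (n C t)        ∎
  where open ≡-Reasoning

squareCertificate-boundary : ∀ n a → squareCertificate (suc (suc n)) (suc a) 0 ≡ chiTerm (suc n) 1 a
squareCertificate-boundary n a with 0 + 2 * suc a + 0 ≤? suc (suc n)
... | yes le with coordinates 0 a 0 le
...   | m , refl = trans (squareCertificate-at m 0 a) (sym (chiTerm-as-multinomial m a 0))
squareCertificate-boundary n zero    | no ¬le = ⊥-elim (¬le (s≤s (s≤s z≤n)))
squareCertificate-boundary n (suc a) | no ¬le =
  squareCertificate-off _ (suc a) 0 (λ le → ¬le (subst (_≤ suc (suc n)) (sym (ℕP.+-identityʳ _)) le))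

formula-recurrence : ∀ n t e →
  formula (suc (suc n)) t e ≡ cornerSum ℚ._+_ 0ℚ (λ t e → formula (suc n) t e) t e
formula-recurrence n zero zero = trans (formula-e0 (suc (suc n)) 0) refl
formula-recurrence n (suc t) zero = begin
  formula (suc (suc n)) (suc t) 0                       ≡⟨ formula-e0 (suc (suc n)) (suc t) ⟩
  chiTerm (suc (suc n)) (suc t) 0                       ≡⟨ chiTerm-pascal n t ⟩
  chiTerm (suc n) (suc t) 0 ℚ.+ chiTerm (suc n) t 0
    ≡⟨ cong₂ ℚ._+_ (formula-e0 (suc n) (suc t)) (formula-e0 (suc n) t) ⟨
  formula (suc n) (suc t) 0 ℚ.+ formula (suc n) t 0     ∎
  where open ≡-Reasoning
formula-recurrence n zero (suc a) = begin
  formula (suc (suc n)) 0 (suc a)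
    ≡⟨ formula-sum (suc (suc n)) 0 (suc a) ⟩
  0ℚ ℚ.+ sumBelow L (summand (suc (suc n)) 0 (suc a))
    ≡⟨ cong (0ℚ ℚ.+_) (sumBelow-cong L (summand-square n a)) ⟩
  0ℚ ℚ.+ sumBelow L (λ d → s₁ d ℚ.+ s₂ d ℚ.+ (H d ℚ.- H (suc d)))
    ≡⟨ cong (0ℚ ℚ.+_) (trans (sumBelow-+ L (λ d → s₁ d ℚ.+ s₂ d) (λ d → H d ℚ.- H (suc d)))
                             (cong₂ ℚ._+_ (sumBelow-+ L s₁ s₂) (sumBelow-telescope L H))) ⟩
  0ℚ ℚ.+ (sumBelow L s₁ ℚ.+ sumBelow L s₂ ℚ.+ (H 0 ℚ.- H L))
    ≡⟨ cong₂ (λ x y → 0ℚ ℚ.+ (sumBelow L s₁ ℚ.+ sumBelow L s₂ ℚ.+ (x ℚ.- y)))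
             (squareCertificate-boundary n a) H-beyond ⟩
  0ℚ ℚ.+ (sumBelow L s₁ ℚ.+ sumBelow L s₂ ℚ.+ (chiTerm (suc n) 1 a ℚ.- 0ℚ))
    ≡⟨ rearrange (sumBelow L s₁) (sumBelow L s₂) (chiTerm (suc n) 1 a) ⟩
  (0ℚ ℚ.+ sumBelow L s₁) ℚ.+ (chiTerm (suc n) 1 a ℚ.+ sumBelow L s₂)
    ≡⟨ cong₂ ℚ._+_ (formula-sum-extended (suc n) 0 (suc a)) (formula-sum-extended (suc n) 1 a) ⟨
  formula (suc n) 0 (suc a) ℚ.+ formula (suc n) 1 a ∎
  where
  open ≡-Reasoning
  L = suc (suc (suc n))
  s₁ = summand (suc n) 0 (suc a)
  s₂ = summand (suc n) 1 a
  H = squareCertificate (suc (suc n)) (suc a)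
  H-beyond : H L ≡ 0ℚ
  H-beyond = squareCertificate-off _ a L (λ le → ℕP.1+n≰n (ℕP.m+n≤o⇒m≤o L le))
  rearrange : ∀ x y c → 0ℚ ℚ.+ (x ℚ.+ y ℚ.+ (c ℚ.- 0ℚ)) ≡ (0ℚ ℚ.+ x) ℚ.+ (c ℚ.+ y)
  rearrange = solve-∀ ℚ-ring
formula-recurrence n (suc t) (suc a) = begin
  formula (suc (suc n)) (suc t) (suc a)
    ≡⟨ formula-sum (suc (suc n)) (suc t) (suc a) ⟩
  0ℚ ℚ.+ sumBelow L (summand (suc (suc n)) (suc t) (suc a))
    ≡⟨ cong (0ℚ ℚ.+_) (sumBelow-cong L (summand-pascal n t a)) ⟩
  0ℚ ℚ.+ sumBelow L (λ d → s₁ d ℚ.+ s₂ d ℚ.+ s₃ d ℚ.+ G d)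
    ≡⟨ cong (0ℚ ℚ.+_) (trans (sumBelow-+ L (λ d → s₁ d ℚ.+ s₂ d ℚ.+ s₃ d) G)
                             (cong (ℚ._+ sumBelow L G) (trans (sumBelow-+ L (λ d → s₁ d ℚ.+ s₂ d) s₃)
                                                              (cong (ℚ._+ sumBelow L s₃) (sumBelow-+ L s₁ s₂))))) ⟩
  0ℚ ℚ.+ (sumBelow L s₁ ℚ.+ sumBelow L s₂ ℚ.+ sumBelow L s₃ ℚ.+ (χ ℚ.+ sumBelow (suc (suc n)) s₁))
    ≡⟨ rearrange (sumBelow L s₁) (sumBelow L s₂) (sumBelow L s₃) χ (sumBelow (suc (suc n)) s₁) ⟩
  ((0ℚ ℚ.+ sumBelow (suc (suc n)) s₁) ℚ.+ (0ℚ ℚ.+ sumBelow L s₂)) ℚ.+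
    ((0ℚ ℚ.+ sumBelow L s₁) ℚ.+ (χ ℚ.+ sumBelow L s₃))
    ≡⟨ cong₂ ℚ._+_
         (cong₂ ℚ._+_ (formula-sum (suc n) (suc t) (suc a)) (formula-sum-extended (suc n) t (suc a)))
         (cong₂ ℚ._+_ (formula-sum-extended (suc n) (suc t) (suc a)) (formula-sum-extended (suc n) (suc (suc t)) a)) ⟨
  (formula (suc n) (suc t) (suc a) ℚ.+ formula (suc n) t (suc a)) ℚ.+
    (formula (suc n) (suc t) (suc a) ℚ.+ formula (suc n) (suc (suc t)) a) ∎
  where
  open ≡-Reasoning
  L = suc (suc (suc n))
  s₁ = summand (suc n) (suc t) (suc a)
  s₂ = summand (suc n) t (suc a)
  s₃ = summand (suc n) (suc (suc t)) a
  χ = chiTerm (suc n) (suc (suc t)) a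
  G = χ ◃ s₁
  rearrange : ∀ x₁ x₂ x₃ c x₁′ → 0ℚ ℚ.+ (x₁ ℚ.+ x₂ ℚ.+ x₃ ℚ.+ (c ℚ.+ x₁′)) ≡
    ((0ℚ ℚ.+ x₁′) ℚ.+ (0ℚ ℚ.+ x₂)) ℚ.+ ((0ℚ ℚ.+ x₁) ℚ.+ (c ℚ.+ x₃))
  rearrange = solve-∀ ℚ-ring

ι-cornerSum : ∀ {f : ℕ → ℕ → ℕ} {g : ℕ → ℕ → ℚ} → (∀ t e → ι (f t e) ≡ g t e) →
  ∀ t e → ι (cornerSum _+_ 0 f t e) ≡ cornerSum ℚ._+_ 0ℚ g t e
ι-cornerSum {f} f≗g zero    zero    = refl
ι-cornerSum {f} f≗g (suc t) zero    = ι-+-cong (f (suc t) 0) (f t 0) (f≗g (suc t) 0) (f≗g t 0)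
ι-cornerSum {f} f≗g zero    (suc a) = ι-+-cong (f 0 (suc a)) (f 1 a) (f≗g 0 (suc a)) (f≗g 1 a)
ι-cornerSum {f} f≗g (suc t) (suc a) =
  ι-+-cong (f₁ + f t (suc a)) (f₁ + f (suc (suc t)) a)
    (ι-+-cong f₁ (f t (suc a)) (f≗g (suc t) (suc a)) (f≗g t (suc a)))
    (ι-+-cong f₁ (f (suc (suc t)) a) (f≗g (suc t) (suc a)) (f≗g (suc (suc t)) a))
  where f₁ = f (suc t) (suc a)

formula-at-1 : ∀ t e → formula 1 t e ≡ chiTerm 1 t e
formula-at-1 t zero    = formula-e0 1 t
formula-at-1 t (suc a) = trans (formula-sum 1 t (suc a)) (cong (0ℚ ℚ.+_) (sumBelow-zero 2 empty))
  where
  empty : ∀ d → summand 1 t (suc a) d ≡ 0ℚ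
  empty d = summand-off 1 t (suc a) d (λ le → ℕP.1+n≰n (ℕP.≤-trans (two≤ d a t) le))
    where
    two≤ : ∀ d a t → 2 ≤ d + 2 * suc a + t
    two≤ d a t = subst (2 ≤_) (sym (level d a t)) (s≤s (s≤s z≤n))
      where
      level : ∀ d a t → d + 2 * suc a + t ≡ suc (suc (d + 2 * a + t))
      level = solve-∀ ℕ-Solver.ring

numSVT≡formula-at-1 : ∀ t e → ι (numSVT (e + t) e 1) ≡ formula 1 t e
numSVT≡formula-at-1 t e = trans (cong ι (numSVT-suc e t 0)) (trans (base t e) (sym (formula-at-1 t e)))
  where
  0<m+suc : ∀ m k → 0 < m + suc k
  0<m+suc m k = subst (0 <_) (sym (ℕP.+-suc m k)) (s≤s z≤n)
  base : ∀ t e → ι (cornerSum _+_ 0 (λ t e → numSVT (e + t) e 0) t e) ≡ chiTerm 1 t e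
  base zero          zero    = refl
  base (suc zero)    zero    = refl
  base (suc (suc t)) zero    = refl
  base zero          (suc a) =
    cong ι (cong₂ _+_ (numSVT-no-entries (suc a + 0) (suc a) (s≤s z≤n)) (numSVT-no-entries (a + 1) a (0<m+suc a 0)))
  base (suc t)       (suc a) =
    cong ι (cong₂ _+_ (cong₂ _+_ (numSVT-no-entries (suc a + suc t) (suc a) (s≤s z≤n))
                                 (numSVT-no-entries (suc a + t) (suc a) (s≤s z≤n)))
                      (cong₂ _+_ (numSVT-no-entries (suc a + suc t) (suc a) (s≤s z≤n))
                                 (numSVT-no-entries (a + suc (suc t)) a (0<m+suc a (suc t)))))

numSVT≡formula : ∀ n t e → ι (numSVT (e + t) e (suc n)) ≡ formula (suc n) t e
numSVT≡formula zero    t e = numSVT≡formula-at-1 t e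
numSVT≡formula (suc n) t e = begin
  ι (numSVT (e + t) e (suc (suc n)))                            ≡⟨ cong ι (numSVT-suc e t (suc n)) ⟩
  ι (cornerSum _+_ 0 (λ t e → numSVT (e + t) e (suc n)) t e)    ≡⟨ ι-cornerSum (numSVT≡formula n) t e ⟩
  cornerSum ℚ._+_ 0ℚ (λ t e → formula (suc n) t e) t e          ≡⟨ formula-recurrence n t e ⟨
  formula (suc (suc n)) t e                                     ∎
  where open ≡-Reasoning

open import Data.Integer using (+_)
open import Data.Rational using (_/_)

corollary2 : (n t e : ℕ) → 1 ≤ n →
    (+ numSVT (e + t) e n) / 1 ≡ formula n t e
corollary2 (suc n) t e _ = numSVT≡formula n t e
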